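{- $$\sum_{n\ge0}\sum_{\pi\in\mathfrak M_n}t^np^{\#\{\text{rises in }\pi\}}q^{\#\{\text{descents in }\pi\}}=\frac{1-qt-2pq(1-q)t^2-\sqrt{(1-qt)^2-4pqt^2}}{2pq^2t^2}.$$
   Context: A permutation $\pi=\pi_1\cdots\pi_n$ is a Motzkin permutation if it avoids the pattern $132$ (no $i<j<k$ with $\pi_i<\pi_k<\pi_j$) and there are no indices $a<b$ with $\pi_a<\pi_b<\pi_{b+1}$; $\mathfrak M_n$ is the set of them. A rise of $\pi$ is an index $i$ with $\pi_i<\pi_{i+1}$, a descent an index $i$ with $\pi_i>\pi_{i+1}$. -}

module Defs where

open import Data.Bool using (Bool; true; false; _∧_; _∨_; not; if_then_else_)
open import Data.Bool.Properties using (T?)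
open import Data.Nat using (ℕ; zero; suc; _<ᵇ_; _≡ᵇ_; _∸_)
open import Data.Product using (_×_; _,_; Σ)
open import Data.List using (List; []; _∷_; length; filter; map; concatMap; upTo)
open import Data.Bool.ListAction using (any)
open import Data.Integer using (ℤ; +_; -_) renaming (_+_ to _+ℤ_; _*_ to _*ℤ_)
open import Relation.Binary.PropositionalEquality using (_≡_)

-- A permutation of length n is a list of length n containing each of
-- 0, 1, …, n-1 exactly once (values shifted by one w.r.t. 1..n; all
-- notions below only depend on the relative order of the entries).

words : ℕ → ℕ → List (List ℕ)
words m zero    = [] ∷ []
words m (suc n) = concatMap (λ w → map (λ x → x ∷ w) (upTo m)) (words m n)

distinct : List ℕ → Bool
distinct []       = true
distinct (x ∷ xs) = not (any (λ y → x ≡ᵇ y) xs) ∧ distinct xs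

perms : ℕ → List (List ℕ)
perms n = filter (λ w → T? (distinct w)) (words n n)

adjPairs : List ℕ → List (ℕ × ℕ)
adjPairs []           = []
adjPairs (x ∷ [])     = []
adjPairs (x ∷ y ∷ xs) = (x , y) ∷ adjPairs (y ∷ xs)

-- an occurrence of 132: i < j < k with π_i < π_k < π_j
-- (here x = π_i, y = π_j, z = π_k)
has132From : ℕ → List ℕ → Bool
has132From x []       = false
has132From x (y ∷ ys) = any (λ z → (x <ᵇ z) ∧ (z <ᵇ y)) ys ∨ has132From x ys

has132 : List ℕ → Bool
has132 []       = false
has132 (x ∷ xs) = has132From x xs ∨ has132 xs

-- indices a < b with π_a < π_b < π_{b+1}
-- (here x = π_a and (y , z) = (π_b , π_{b+1}))
hasBad : List ℕ → Bool
hasBad []       = false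
hasBad (x ∷ xs) = any (λ { (y , z) → (x <ᵇ y) ∧ (y <ᵇ z) }) (adjPairs xs) ∨ hasBad xs

isMotzkin : List ℕ → Bool
isMotzkin w = not (has132 w) ∧ not (hasBad w)

rises : List ℕ → ℕ
rises w = length (filter (λ { (y , z) → T? (y <ᵇ z) }) (adjPairs w))

descents : List ℕ → ℕ
descents w = length (filter (λ { (y , z) → T? (z <ᵇ y) }) (adjPairs w))

-- Formal power series in t with coefficients in ℤ[p,q]:
-- s n a b = coefficient of t^n p^a q^b.

Series : Set
Series = ℕ → ℕ → ℕ → ℤ

_≈_ : Series → Series → Set
f ≈ g = ∀ n a b → f n a b ≡ g n a b

sumTo : ℕ → (ℕ → ℤ) → ℤ
sumTo zero    f = f zero
sumTo (suc n) f = sumTo n f +ℤ f (suc n)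

_⊕_ : Series → Series → Series
(f ⊕ g) n a b = f n a b +ℤ g n a b

⊖_ : Series → Series
(⊖ f) n a b = - f n a b

_⊝_ : Series → Series → Series
f ⊝ g = f ⊕ (⊖ g)

_⊗_ : Series → Series → Series
(f ⊗ g) n a b =
  sumTo n λ i → sumTo a λ j → sumTo b λ k →
    f i j k *ℤ g (n ∸ i) (a ∸ j) (b ∸ k)

mono : ℤ → ℕ → ℕ → ℕ → Series
mono c i j k n a b = if (n ≡ᵇ i) ∧ (a ≡ᵇ j) ∧ (b ≡ᵇ k) then c else + 0

one t p q : Series
one = mono (+ 1) 0 0 0
t   = mono (+ 1) 1 0 0
p   = mono (+ 1) 0 1 0
q   = mono (+ 1) 0 0 1

_·_ : ℤ → Series → Series
(c · f) n a b = c *ℤ f n a b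

-- The generating function of the statement:
-- M n a b = #{ π ∈ 𝔐_n : π has a rises and b descents }.

countM : ℕ → ℕ → ℕ → ℕ
countM n a b = length (filter
  (λ w → T? (isMotzkin w ∧ (rises w ≡ᵇ a) ∧ (descents w ≡ᵇ b))) (perms n))

M : Series
M n a b = + countM n a b

IsSqrt : Series → Series → Set
IsSqrt A S = (∀ a b → S 0 a b ≡ one 0 a b) × ((S ⊗ S) ≈ A)

radicand : Series
radicand = ((one ⊝ (q ⊗ t)) ⊗ (one ⊝ (q ⊗ t))) ⊝ ((+ 4) · (p ⊗ (q ⊗ (t ⊗ t))))

numerator : Series → Series
numerator S =
  ((one ⊝ (q ⊗ t)) ⊝ ((+ 2) · (p ⊗ (q ⊗ ((one ⊝ q) ⊗ (t ⊗ t)))))) ⊝ S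

denominator : Series
denominator = (+ 2) · (p ⊗ (q ⊗ (q ⊗ (t ⊗ t))))

module Submission where

-- A Motzkin permutation of length n + 2 with maximum N either starts with N, followed by a
-- Motzkin permutation of length n + 1, or it is α′ j N β: avoiding 132 forces every entry before N
-- to exceed every entry after it, so β is a Motzkin permutation of {0, …, j - 1} with j = |β|;
-- avoiding 1-23 forces the entry just before N to be the least entry before N, that is j; and α′
-- is a Motzkin permutation α shifted above j. Counting each π by t^|π| p^rises q^descents (series M)
-- and also by the rises and descents of N π (series U = 1 + q (M - 1)), this gives
-- M = 1 + t U + p t² U², hence U = 1 + q t U + p q t² U². So K = p q t² U satisfies
-- K = p q t² + q t K + K², that is, S = 1 - q t - 2 K satisfies S² = (1 - q t)² - 4 p q t².
-- Square roots with constant term 1 are unique, and S = 1 - q t - 2 p q t² (1 + q (M - 1)) is the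
-- stated formula solved for S.

import Defs
open import Algebra.Bundles using (CommutativeRing)
import Algebra.Construct.Pointwise as Pointwise
import Algebra.Solver.Ring as RingSolver
open import Algebra.Solver.Ring.AlmostCommutativeRing using (fromCommutativeRing; _-Raw-AlmostCommutative⟶_)
open import Data.Bool using (Bool; true; false; T; _∧_)
open import Data.Bool.Properties using (T?)
open import Data.Integer as ℤ using (ℤ)
import Data.Integer.Properties as ℤ
open import Data.List using (List; []; _∷_; _++_; map; length; filter; cartesianProductWith)
open import Data.List.Membership.Propositional using (_∈_)
open import Data.List.Relation.Binary.Permutation.Propositional using (_↭_)
open import Data.List.Relation.Binary.Permutation.Propositional.Properties using (filter-↭; ↭-length)
open import Data.List.Relation.Unary.Any using (here; there)
open import Data.Maybe using (Maybe; just; nothing)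
open import Data.Nat using (ℕ; zero; suc; _∸_; _≤_; z≤n; s≤s; _≡ᵇ_)
import Data.Nat as ℕ
import Data.Nat.Properties as ℕ
open import Data.Product using (_×_; _,_; Σ; proj₁; proj₂)
open import Function using (_∘_; Equivalence)
open import Relation.Nullary using (yes; no)
open import Relation.Binary.PropositionalEquality as ≡ using (_≡_)

open Equivalence using (to; from)

module FormalPowerSeries {c ℓ} (R : CommutativeRing c ℓ) where

  open CommutativeRing R renaming (zero to *-zero)
  open import Relation.Binary.Reasoning.Setoid setoid
  open import Algebra.Properties.Ring ring using (+-cancelʳ)
  open import Algebra.Properties.CommutativeSemigroup +-commutativeSemigroup using (interchange)

  ∑ : ℕ → (ℕ → Carrier) → Carrier
  ∑ zero    f = f zero
  ∑ (suc n) f = ∑ n f + f (suc n)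

  syntax ∑ n (λ i → e) = ∑[ i ≤ n ] e

  ∑-cong≤ : ∀ n {f g} → (∀ {i} → i ≤ n → f i ≈ g i) → ∑ n f ≈ ∑ n g
  ∑-cong≤ zero    f≈g = f≈g z≤n
  ∑-cong≤ (suc n) f≈g = +-cong (∑-cong≤ n (f≈g ∘ ℕ.m≤n⇒m≤1+n)) (f≈g ℕ.≤-refl)

  ∑-cong : ∀ n {f g} → (∀ i → f i ≈ g i) → ∑ n f ≈ ∑ n g
  ∑-cong n f≈g = ∑-cong≤ n (λ {i} _ → f≈g i)

  ∑-head : ∀ n f → ∑ (suc n) f ≈ f 0 + ∑ n (f ∘ suc)
  ∑-head zero    f = refl
  ∑-head (suc n) f = begin
    ∑ (suc n) f + f (suc (suc n))             ≈⟨ +-congʳ (∑-head n f) ⟩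
    (f 0 + ∑ n (f ∘ suc)) + f (suc (suc n))   ≈⟨ +-assoc _ _ _ ⟩
    f 0 + ∑ (suc n) (f ∘ suc)                 ∎

  ∑-zero : ∀ n {f} → (∀ i → f i ≈ 0#) → ∑ n f ≈ 0#
  ∑-zero zero    f≈0 = f≈0 0
  ∑-zero (suc n) f≈0 = trans (+-cong (∑-zero n f≈0) (f≈0 (suc n))) (+-identityˡ 0#)

  ∑-+ : ∀ n f g → ∑[ i ≤ n ] (f i + g i) ≈ ∑ n f + ∑ n g
  ∑-+ zero    f g = refl
  ∑-+ (suc n) f g = trans (+-congʳ (∑-+ n f g)) (interchange _ _ _ _)

  ∑-*ˡ : ∀ n x f → x * ∑ n f ≈ ∑[ i ≤ n ] (x * f i)
  ∑-*ˡ zero    x f = refl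
  ∑-*ˡ (suc n) x f = trans (distribˡ x _ _) (+-congʳ (∑-*ˡ n x f))

  ∑-*ʳ : ∀ n x f → ∑ n f * x ≈ ∑[ i ≤ n ] (f i * x)
  ∑-*ʳ zero    x f = refl
  ∑-*ʳ (suc n) x f = trans (distribʳ x _ _) (+-congʳ (∑-*ʳ n x f))

  ∑-reverse : ∀ n f → ∑ n f ≈ ∑[ i ≤ n ] f (n ∸ i)
  ∑-reverse zero    f = refl
  ∑-reverse (suc n) f = begin
    ∑ n f + f (suc n)                  ≈⟨ +-congʳ (∑-reverse n f) ⟩
    ∑[ i ≤ n ] f (n ∸ i) + f (suc n)   ≈⟨ +-comm _ _ ⟩
    f (suc n) + ∑[ i ≤ n ] f (n ∸ i)   ≈⟨ ∑-head n (λ i → f (suc n ∸ i)) ⟨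
    ∑[ i ≤ suc n ] f (suc n ∸ i)       ∎

  ∑-triangle : ∀ n (F : ℕ → ℕ → Carrier) →
    ∑[ i ≤ n ] ∑[ j ≤ i ] F j i ≈ ∑[ j ≤ n ] ∑[ k ≤ n ∸ j ] F j (j ℕ.+ k)
  ∑-triangle zero    F = refl
  ∑-triangle (suc n) F = begin
    ∑[ i ≤ n ] ∑[ j ≤ i ] F j i + (∑[ j ≤ n ] F j (suc n) + F (suc n) (suc n))
      ≈⟨ +-congʳ (∑-triangle n F) ⟩
    ∑[ j ≤ n ] ∑[ k ≤ n ∸ j ] F j (j ℕ.+ k) + (∑[ j ≤ n ] F j (suc n) + F (suc n) (suc n))
      ≈⟨ +-assoc _ _ _ ⟨
    (∑[ j ≤ n ] ∑[ k ≤ n ∸ j ] F j (j ℕ.+ k) + ∑[ j ≤ n ] F j (suc n)) + F (suc n) (suc n)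
      ≈⟨ +-cong (sym (∑-+ n _ _)) (reflexive (≡.cong (F (suc n)) (≡.sym (ℕ.+-identityʳ (suc n))))) ⟩
    ∑[ j ≤ n ] (∑[ k ≤ n ∸ j ] F j (j ℕ.+ k) + F j (suc n)) + F (suc n) (suc n ℕ.+ 0)
      ≈⟨ +-cong (∑-cong≤ n column) (reflexive (≡.cong (λ m → ∑[ k ≤ m ] F (suc n) (suc n ℕ.+ k)) (ℕ.n∸n≡0 n))) ⟨
    ∑[ j ≤ suc n ] ∑[ k ≤ suc n ∸ j ] F j (j ℕ.+ k) ∎
    where
    column : ∀ {j} → j ≤ n → ∑[ k ≤ suc n ∸ j ] F j (j ℕ.+ k) ≈ ∑[ k ≤ n ∸ j ] F j (j ℕ.+ k) + F j (suc n)
    column {j} j≤n = begin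
      ∑[ k ≤ suc n ∸ j ] F j (j ℕ.+ k)     ≡⟨ ≡.cong (λ m → ∑[ k ≤ m ] F j (j ℕ.+ k)) (ℕ.+-∸-assoc 1 j≤n) ⟩
      ∑[ k ≤ suc (n ∸ j) ] F j (j ℕ.+ k)   ≡⟨ ≡.cong (λ m → ∑[ k ≤ n ∸ j ] F j (j ℕ.+ k) + F j m) j+suc[n∸j]≡suc-n ⟩
      ∑[ k ≤ n ∸ j ] F j (j ℕ.+ k) + F j (suc n) ∎
      where
      j+suc[n∸j]≡suc-n : j ℕ.+ suc (n ∸ j) ≡ suc n
      j+suc[n∸j]≡suc-n = ≡.trans (ℕ.+-suc j (n ∸ j)) (≡.cong suc (ℕ.m+[n∸m]≡n j≤n))

  PowerSeries : Set c
  PowerSeries = ℕ → Carrier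

  infix 4 _≋_
  _≋_ : PowerSeries → PowerSeries → Set ℓ
  f ≋ g = ∀ n → f n ≈ g n

  infixl 6 _+ₛ_
  _+ₛ_ : PowerSeries → PowerSeries → PowerSeries
  (f +ₛ g) n = f n + g n

  infixl 7 _*ₛ_
  _*ₛ_ : PowerSeries → PowerSeries → PowerSeries
  (f *ₛ g) n = ∑[ i ≤ n ] (f i * g (n ∸ i))

  const : Carrier → PowerSeries
  const x zero    = x
  const x (suc n) = 0#

  shift : PowerSeries → PowerSeries
  shift f zero    = 0#
  shift f (suc n) = f n

  X : PowerSeries
  X = shift (const 1#)

  *ₛ-cong : ∀ {f f′ g g′} → f ≋ f′ → g ≋ g′ → f *ₛ g ≋ f′ *ₛ g′
  *ₛ-cong f≋f′ g≋g′ n = ∑-cong n (λ i → *-cong (f≋f′ i) (g≋g′ (n ∸ i)))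

  *ₛ-comm : ∀ f g → f *ₛ g ≋ g *ₛ f
  *ₛ-comm f g n = begin
    ∑[ i ≤ n ] (f i * g (n ∸ i))              ≈⟨ ∑-reverse n _ ⟩
    ∑[ i ≤ n ] (f (n ∸ i) * g (n ∸ (n ∸ i)))  ≈⟨ ∑-cong≤ n swap ⟩
    ∑[ i ≤ n ] (g i * f (n ∸ i))              ∎
    where
    swap : ∀ {i} → i ≤ n → f (n ∸ i) * g (n ∸ (n ∸ i)) ≈ g i * f (n ∸ i)
    swap i≤n = trans (*-comm _ _) (*-congʳ (reflexive (≡.cong g (ℕ.m∸[m∸n]≡n i≤n))))

  *ₛ-assoc : ∀ f g h → (f *ₛ g) *ₛ h ≋ f *ₛ (g *ₛ h)
  *ₛ-assoc f g h n = begin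
    ∑[ i ≤ n ] (∑[ j ≤ i ] (f j * g (i ∸ j)) * h (n ∸ i))
      ≈⟨ ∑-cong n (λ i → ∑-*ʳ i _ _) ⟩
    ∑[ i ≤ n ] ∑[ j ≤ i ] (f j * g (i ∸ j) * h (n ∸ i))
      ≈⟨ ∑-triangle n _ ⟩
    ∑[ j ≤ n ] ∑[ k ≤ n ∸ j ] (f j * g (j ℕ.+ k ∸ j) * h (n ∸ (j ℕ.+ k)))
      ≈⟨ ∑-cong n (λ j → ∑-cong (n ∸ j) (λ k → reassociate j k)) ⟩
    ∑[ j ≤ n ] ∑[ k ≤ n ∸ j ] (f j * (g k * h (n ∸ j ∸ k)))
      ≈⟨ ∑-cong n (λ j → sym (∑-*ˡ (n ∸ j) (f j) _)) ⟩
    ∑[ j ≤ n ] (f j * ∑[ k ≤ n ∸ j ] (g k * h (n ∸ j ∸ k))) ∎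
    where
    reassociate : ∀ j k → f j * g (j ℕ.+ k ∸ j) * h (n ∸ (j ℕ.+ k)) ≈ f j * (g k * h (n ∸ j ∸ k))
    reassociate j k = trans (*-assoc _ _ _) (*-congˡ (*-cong
      (reflexive (≡.cong g (ℕ.m+n∸m≡n j k))) (reflexive (≡.cong h (≡.sym (ℕ.∸-+-assoc n j k))))))

  *ₛ-distribʳ : ∀ f g h → (g +ₛ h) *ₛ f ≋ g *ₛ f +ₛ h *ₛ f
  *ₛ-distribʳ f g h n = trans (∑-cong n (λ i → distribʳ _ _ _)) (∑-+ n _ _)

  const-*ₛ : ∀ x f n → (const x *ₛ f) n ≈ x * f n
  const-*ₛ x f zero    = refl
  const-*ₛ x f (suc n) = begin
    (const x *ₛ f) (suc n)                      ≈⟨ ∑-head n _ ⟩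
    x * f (suc n) + ∑[ i ≤ n ] (0# * f (n ∸ i)) ≈⟨ +-congˡ (∑-zero n (λ i → zeroˡ _)) ⟩
    x * f (suc n) + 0#                          ≈⟨ +-identityʳ _ ⟩
    x * f (suc n)                               ∎

  shift-*ₛ : ∀ f g → shift f *ₛ g ≋ shift (f *ₛ g)
  shift-*ₛ f g zero    = zeroˡ _
  shift-*ₛ f g (suc n) = begin
    (shift f *ₛ g) (suc n)                  ≈⟨ ∑-head n _ ⟩
    0# * g (suc n) + (f *ₛ g) n             ≈⟨ +-congʳ (zeroˡ _) ⟩
    0# + (f *ₛ g) n                         ≈⟨ +-identityˡ _ ⟩
    (f *ₛ g) n                              ∎

  X-*ₛ : ∀ f → X *ₛ f ≋ shift f
  X-*ₛ f n = trans (shift-*ₛ (const 1#) f n) (shift-cong n)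
    where
    shift-cong : ∀ n → shift (const 1# *ₛ f) n ≈ shift f n
    shift-cong zero    = refl
    shift-cong (suc n) = trans (const-*ₛ 1# f n) (*-identityˡ _)

  commutativeRing : CommutativeRing c ℓ
  commutativeRing = record
    { Carrier = PowerSeries
    ; _≈_ = _≋_
    ; _+_ = _+ₛ_
    ; _*_ = _*ₛ_
    ; -_ = λ f n → - f n
    ; 0# = λ _ → 0#
    ; 1# = const 1#
    ; isCommutativeRing = record
      { isRing = record
        { +-isAbelianGroup = Pointwise.isAbelianGroup ℕ +-isAbelianGroup
        ; *-cong = *ₛ-cong
        ; *-assoc = *ₛ-assoc
        ; *-identity = (λ f n → trans (const-*ₛ 1# f n) (*-identityˡ _))
                     , (λ f n → trans (*ₛ-comm f (const 1#) n) (trans (const-*ₛ 1# f n) (*-identityˡ _)))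
        ; distrib = (λ f g h n → trans (*ₛ-comm f (g +ₛ h) n)
                                   (trans (*ₛ-distribʳ f g h n) (+-cong (*ₛ-comm g f n) (*ₛ-comm h f n))))
                  , *ₛ-distribʳ
        }
      ; *-comm = *ₛ-comm
      }
    }

  const-cong : ∀ {x y} → x ≈ y → const x ≋ const y
  const-cong x≈y zero    = x≈y
  const-cong x≈y (suc n) = refl

  const-+ : ∀ x y → const (x + y) ≋ const x +ₛ const y
  const-+ x y zero    = refl
  const-+ x y (suc n) = sym (+-identityˡ 0#)

  const-* : ∀ x y → const (x * y) ≋ const x *ₛ const y
  const-* x y zero    = refl
  const-* x y (suc n) = sym (trans (const-*ₛ x (const y) (suc n)) (zeroʳ x))

  middleTerms : PowerSeries → ℕ → Carrier
  middleTerms S zero    = 0#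
  middleTerms S (suc k) = ∑[ i ≤ k ] (S (suc i) * S (suc k ∸ i))

  square-coeff-suc : ∀ {S} → S 0 ≈ 1# → ∀ m → (S *ₛ S) (suc m) ≈ (S (suc m) + S (suc m)) + middleTerms S m
  square-coeff-suc {S} S₀≈1 zero = begin
    S 0 * S 1 + S 1 * S 0      ≈⟨ +-cong (trans (*-congʳ S₀≈1) (*-identityˡ _)) (trans (*-congˡ S₀≈1) (*-identityʳ _)) ⟩
    S 1 + S 1                  ≈⟨ +-identityʳ _ ⟨
    (S 1 + S 1) + 0#           ∎
  square-coeff-suc {S} S₀≈1 (suc k) = begin
    ∑[ i ≤ suc k ] (S i * S (suc (suc k) ∸ i)) + S (suc (suc k)) * S (k ∸ k)
      ≈⟨ +-cong (∑-head k _) (*-congˡ (reflexive (≡.cong S (ℕ.n∸n≡0 k)))) ⟩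
    (S 0 * a + middleTerms S (suc k)) + a * S 0
      ≈⟨ +-cong (+-congʳ (trans (*-congʳ S₀≈1) (*-identityˡ a))) (trans (*-congˡ S₀≈1) (*-identityʳ a)) ⟩
    (a + middleTerms S (suc k)) + a
      ≈⟨ trans (+-assoc _ _ _) (trans (+-congˡ (+-comm _ _)) (sym (+-assoc _ _ _))) ⟩
    (a + a) + middleTerms S (suc k) ∎
    where
    a : Carrier
    a = S (suc (suc k))

  middleTerms-cong : ∀ {S S′} m → (∀ {i} → i ≤ m → S i ≈ S′ i) → middleTerms S m ≈ middleTerms S′ m
  middleTerms-cong zero    S≈S′ = refl
  middleTerms-cong (suc k) S≈S′ = ∑-cong≤ k λ {i} i≤k → *-cong (S≈S′ (s≤s i≤k)) (S≈S′ (ℕ.m∸n≤m (suc k) i))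

  square-root-unique : (∀ {x y} → x + x ≈ y + y → x ≈ y) → ∀ {S S′} →
    S 0 ≈ 1# → S′ 0 ≈ 1# → S *ₛ S ≋ S′ *ₛ S′ → S ≋ S′
  square-root-unique halve {S} {S′} S₀≈1 S′₀≈1 S²≋S′² n = agree n ℕ.≤-refl
    where
    agree : ∀ m {i} → i ≤ m → S i ≈ S′ i
    agree m       {zero}  _          = trans S₀≈1 (sym S′₀≈1)
    agree (suc m) {suc i} (s≤s i≤m) = halve (+-cancelʳ (middleTerms S i) _ _ (begin
      (S (suc i) + S (suc i)) + middleTerms S i     ≈⟨ square-coeff-suc S₀≈1 i ⟨
      (S *ₛ S) (suc i)                              ≈⟨ S²≋S′² (suc i) ⟩
      (S′ *ₛ S′) (suc i)                            ≈⟨ square-coeff-suc S′₀≈1 i ⟩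
      (S′ (suc i) + S′ (suc i)) + middleTerms S′ i
        ≈⟨ +-congˡ (middleTerms-cong i (λ j≤i → agree m (ℕ.≤-trans j≤i i≤m))) ⟨
      (S′ (suc i) + S′ (suc i)) + middleTerms S i   ∎))

module _ {c ℓ} (R : CommutativeRing c ℓ) where
  private
    module R⟦x⟧ = FormalPowerSeries R
    module R⟦x,y⟧ = FormalPowerSeries R⟦x⟧.commutativeRing

  ∑-apply : ∀ n F m → R⟦x,y⟧.∑ n F m ≡ R⟦x⟧.∑ n (λ i → F i m)
  ∑-apply zero    F m = ≡.refl
  ∑-apply (suc n) F m = ≡.cong (λ s → CommutativeRing._+_ R s (F (suc n) m)) (∑-apply n F m)


open Defs

-- Series n a b is the coefficient of tⁿ pᵃ qᵇ, so Series is the carrier of ((ℤ⟦q⟧)⟦p⟧)⟦t⟧.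
module ℤ⟦q⟧ = FormalPowerSeries ℤ.+-*-commutativeRing
module ℤ⟦p,q⟧ = FormalPowerSeries ℤ⟦q⟧.commutativeRing
module ℤ⟦t,p,q⟧ = FormalPowerSeries ℤ⟦p,q⟧.commutativeRing
module S = CommutativeRing ℤ⟦t,p,q⟧.commutativeRing

p′ q′ : ℤ⟦p,q⟧.PowerSeries
p′ = ℤ⟦p,q⟧.X
q′ = ℤ⟦p,q⟧.const ℤ⟦q⟧.X

t≈X : t ≈ ℤ⟦t,p,q⟧.X
t≈X zero          a       b       = ≡.refl
t≈X (suc zero)    zero    zero    = ≡.refl
t≈X (suc zero)    zero    (suc b) = ≡.refl
t≈X (suc zero)    (suc a) b       = ≡.refl
t≈X (suc (suc n)) a       b       = ≡.refl

p≈const-p′ : p ≈ ℤ⟦t,p,q⟧.const p′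
p≈const-p′ zero    zero          b       = ≡.refl
p≈const-p′ zero    (suc zero)    zero    = ≡.refl
p≈const-p′ zero    (suc zero)    (suc b) = ≡.refl
p≈const-p′ zero    (suc (suc a)) b       = ≡.refl
p≈const-p′ (suc n) a             b       = ≡.refl

q≈const-q′ : q ≈ ℤ⟦t,p,q⟧.const q′
q≈const-q′ zero    zero    zero          = ≡.refl
q≈const-q′ zero    zero    (suc zero)    = ≡.refl
q≈const-q′ zero    zero    (suc (suc b)) = ≡.refl
q≈const-q′ zero    (suc a) b             = ≡.refl
q≈const-q′ (suc n) a       b             = ≡.refl

one≈1# : one ≈ S.1#
one≈1# zero    zero    zero    = ≡.refl
one≈1# zero    zero    (suc b) = ≡.refl
one≈1# zero    (suc a) b       = ≡.refl
one≈1# (suc n) a       b       = ≡.refl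

sumTo≡∑ : ∀ n f → sumTo n f ≡ ℤ⟦q⟧.∑ n f
sumTo≡∑ zero    f = ≡.refl
sumTo≡∑ (suc n) f = ≡.cong (ℤ._+ f (suc n)) (sumTo≡∑ n f)

⊗≈* : ∀ f g → (f ⊗ g) ≈ (f S.* g)
⊗≈* f g n a b = begin
  (f ⊗ g) n a b
    ≡⟨ ≡.trans (sumTo≡∑ n _) (ℤ⟦q⟧.∑-cong n λ i → ≡.trans (sumTo≡∑ a _) (ℤ⟦q⟧.∑-cong a λ j → sumTo≡∑ b _)) ⟩
  ℤ⟦q⟧.∑ n (λ i → ℤ⟦q⟧.∑ a (λ j → ℤ⟦q⟧.∑ b (λ k → f i j k ℤ.* g (n ∸ i) (a ∸ j) (b ∸ k))))
    ≡⟨ ℤ⟦q⟧.∑-cong n (λ i → ∑-apply ℤ.+-*-commutativeRing a _ b) ⟨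
  ℤ⟦q⟧.∑ n (λ i → ℤ⟦p,q⟧.∑ a (λ j → f i j ℤ⟦q⟧.*ₛ g (n ∸ i) (a ∸ j)) b)
    ≡⟨ ∑-apply ℤ.+-*-commutativeRing n _ b ⟨
  ℤ⟦p,q⟧.∑ n (λ i → ℤ⟦p,q⟧.∑ a (λ j → f i j ℤ⟦q⟧.*ₛ g (n ∸ i) (a ∸ j))) b
    ≡⟨ ≡.cong (λ h → h b) (∑-apply ℤ⟦q⟧.commutativeRing n _ a) ⟨
  (f S.* g) n a b ∎
  where open ≡.≡-Reasoning

module MotzkinPermutations where

  open import Data.Bool using (not; _∨_)
  open import Data.Bool.ListAction using (any)
  open import Data.Bool.Properties using (T-∧; T-∨; T-≡)
  open import Data.Empty using (⊥; ⊥-elim)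
  open import Data.List using ([_]; _∷ʳ_; upTo; concatMap; initLast; _∷ʳ′_)
  open import Data.List.Membership.DecPropositional ℕ._≟_ using (_∈?_)
  open import Data.List.Membership.Propositional using (_∉_; find; lose)
  open import Data.List.Membership.Propositional.Properties
    using (∈-++⁻; ∈-++⁺ˡ; ∈-++⁺ʳ; ∈-map⁻; ∈-map⁺; ∈-∃++; ∈-upTo⁺; ∈-upTo⁻; ∈-filter⁺; ∈-filter⁻;
           ∈-cartesianProductWith⁻; ∈-cartesianProductWith⁺)
  open import Data.List.Membership.Propositional.Properties.WithK using (unique∧set⇒bag)
  open import Data.List.Properties
    using (length-++; length-map; length-upTo; ++-assoc; map-∘; map-id-local; map-injective;
           ∷-injective; ∷-injectiveˡ; ∷-injectiveʳ)
  open import Data.List.Relation.Binary.BagAndSetEquality using (∼bag⇒↭)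
  open import Data.List.Relation.Unary.All as All using (All; []; _∷_)
  open import Data.List.Relation.Unary.All.Properties using (All¬⇒¬Any; ¬Any⇒All¬)
  open import Data.List.Relation.Unary.Any as Any using ()
  open import Data.List.Relation.Unary.Any.Properties using (any⁺; any⁻)
  open import Data.List.Relation.Unary.AllPairs using ([]; _∷_)
  open import Data.List.Relation.Unary.Unique.Propositional using (Unique)
  import Data.List.Relation.Unary.Unique.Propositional.Properties as Unique
  open import Data.Nat using (_+_; _<_; _<ᵇ_)
  open import Data.Product using (∃; ∃₂)
  open import Data.Sum using (_⊎_; inj₁; inj₂)
  open import Function using (_⇔_; mk⇔; case_of_)
  open import Relation.Nullary using (¬_)
  open ≡ using (_≢_; refl; sym; trans; cong; cong₂; subst; module ≡-Reasoning)

  data Before (y z : ℕ) : List ℕ → Set where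
    here  : ∀ {r} → z ∈ r → Before y z (y ∷ r)
    there : ∀ {u r} → Before y z r → Before y z (u ∷ r)

  data Adjacent (y z : ℕ) : List ℕ → Set where
    here  : ∀ {r} → Adjacent y z (y ∷ z ∷ r)
    there : ∀ {u r} → Adjacent y z r → Adjacent y z (u ∷ r)

  data Contains132 : List ℕ → Set where
    here  : ∀ {x y z r} → Before y z r → x < z → z < y → Contains132 (x ∷ r)
    there : ∀ {u r} → Contains132 r → Contains132 (u ∷ r)

  data Contains1-23 : List ℕ → Set where
    here  : ∀ {x y z r} → Adjacent y z r → x < y → y < z → Contains1-23 (x ∷ r)
    there : ∀ {u r} → Contains1-23 r → Contains1-23 (u ∷ r)

  Motzkin : List ℕ → Set
  Motzkin w = ¬ Contains132 w × ¬ Contains1-23 w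

  <ᵇ-∧⇔ : ∀ {x y z} → T ((x <ᵇ y) ∧ (y <ᵇ z)) ⇔ (x < y × y < z)
  <ᵇ-∧⇔ {x} {y} {z} = mk⇔
    (λ h → let (x<y , y<z) = to T-∧ h in ℕ.<ᵇ⇒< x y x<y , ℕ.<ᵇ⇒< y z y<z)
    (λ (x<y , y<z) → from T-∧ (ℕ.<⇒<ᵇ x<y , ℕ.<⇒<ᵇ y<z))

  has132From-sound : ∀ x r → T (has132From x r) → ∃₂ λ y z → Before y z r × x < z × z < y
  has132From-sound x (y ∷ r) h with to T-∨ h
  ... | inj₁ h′ = let z , z∈r , xzy = find (any⁻ _ r h′) in y , z , here z∈r , to <ᵇ-∧⇔ xzy
  ... | inj₂ h′ = let y′ , z , b , xzy = has132From-sound x r h′ in y′ , z , there b , xzy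

  has132From-complete : ∀ {x y z r} → Before y z r → x < z → z < y → T (has132From x r)
  has132From-complete (here z∈r) x<z z<y = from T-∨ (inj₁ (any⁺ _ (lose z∈r (from <ᵇ-∧⇔ (x<z , z<y)))))
  has132From-complete (there b)  x<z z<y = from T-∨ (inj₂ (has132From-complete b x<z z<y))

  has132⇔Contains132 : ∀ w → T (has132 w) ⇔ Contains132 w
  has132⇔Contains132 w = mk⇔ (sound w) complete
    where
    sound : ∀ w → T (has132 w) → Contains132 w
    sound (x ∷ r) h with to T-∨ h
    ... | inj₁ h′ = let _ , _ , b , x<z , z<y = has132From-sound x r h′ in here b x<z z<y
    ... | inj₂ h′ = there (sound r h′)
    complete : ∀ {w} → Contains132 w → T (has132 w)
    complete (here b x<z z<y) = from T-∨ (inj₁ (has132From-complete b x<z z<y))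
    complete (there c)        = from T-∨ (inj₂ (complete c))

  Adjacent⇔∈adjPairs : ∀ {y z} r → Adjacent y z r ⇔ (y , z) ∈ adjPairs r
  Adjacent⇔∈adjPairs r = mk⇔ (to′ r) (from′ r)
    where
    to′ : ∀ {y z} r → Adjacent y z r → (y , z) ∈ adjPairs r
    to′ (_ ∷ _ ∷ _)     here      = here refl
    to′ (_ ∷ v ∷ r)     (there a) = there (to′ (v ∷ r) a)
    from′ : ∀ {y z} r → (y , z) ∈ adjPairs r → Adjacent y z r
    from′ (_ ∷ _ ∷ _)   (here refl) = here
    from′ (_ ∷ v ∷ r)   (there p)   = there (from′ (v ∷ r) p)

  hasBad⇔Contains1-23 : ∀ w → T (hasBad w) ⇔ Contains1-23 w
  hasBad⇔Contains1-23 w = mk⇔ (sound w) complete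
    where
    sound : ∀ w → T (hasBad w) → Contains1-23 w
    sound (x ∷ r) h with to T-∨ h
    ... | inj₁ h′ = let (y , z) , yz∈r , xyz = find (any⁻ _ (adjPairs r) h′)
                        (x<y , y<z) = to <ᵇ-∧⇔ xyz
                    in here (from (Adjacent⇔∈adjPairs r) yz∈r) x<y y<z
    ... | inj₂ h′ = there (sound r h′)
    complete : ∀ {w} → Contains1-23 w → T (hasBad w)
    complete {x ∷ r} (here a x<y y<z) =
      from T-∨ (inj₁ (any⁺ _ (lose (to (Adjacent⇔∈adjPairs r) a) (from <ᵇ-∧⇔ (x<y , y<z)))))
    complete (there c) = from T-∨ (inj₂ (complete c))

  T-not : ∀ {b} → T (not b) ⇔ (¬ T b)
  T-not {true}  = mk⇔ (λ ()) (λ ¬⊤ → ¬⊤ _)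
  T-not {false} = mk⇔ (λ _ ()) (λ _ → _)

  isMotzkin⇔Motzkin : ∀ w → T (isMotzkin w) ⇔ Motzkin w
  isMotzkin⇔Motzkin w = mk⇔
    (λ h → let (h₁ , h₂) = to T-∧ h in
       to T-not h₁ ∘ from (has132⇔Contains132 w) , to T-not h₂ ∘ from (hasBad⇔Contains1-23 w))
    (λ (m₁ , m₂) → from T-∧ ( from T-not (m₁ ∘ to (has132⇔Contains132 w))
                            , from T-not (m₂ ∘ to (hasBad⇔Contains1-23 w))))

  Before-∈ : ∀ {y z r} → Before y z r → y ∈ r × z ∈ r
  Before-∈ (here z∈r) = here refl , there z∈r
  Before-∈ (there b)  = let (y∈ , z∈) = Before-∈ b in there y∈ , there z∈

  Adjacent-∈ : ∀ {y z r} → Adjacent y z r → y ∈ r × z ∈ r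
  Adjacent-∈ here      = here refl , there (here refl)
  Adjacent-∈ (there a) = let (y∈ , z∈) = Adjacent-∈ a in there y∈ , there z∈

  Before-++ˡ : ∀ {y z r} s → Before y z r → Before y z (r ++ s)
  Before-++ˡ s (here z∈r) = here (∈-++⁺ˡ z∈r)
  Before-++ˡ s (there b)  = there (Before-++ˡ s b)

  Adjacent-++ˡ : ∀ {y z r} s → Adjacent y z r → Adjacent y z (r ++ s)
  Adjacent-++ˡ s here      = here
  Adjacent-++ˡ s (there a) = there (Adjacent-++ˡ s a)

  Before-++⁻ : ∀ {y z} us vs → Before y z (us ++ vs) → Before y z us ⊎ (y ∈ us × z ∈ vs) ⊎ Before y z vs
  Before-++⁻ []       vs b          = inj₂ (inj₂ b)
  Before-++⁻ (u ∷ us) vs (here z∈)  with ∈-++⁻ us z∈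
  ... | inj₁ z∈us = inj₁ (here z∈us)
  ... | inj₂ z∈vs = inj₂ (inj₁ (here refl , z∈vs))
  Before-++⁻ (u ∷ us) vs (there b) with Before-++⁻ us vs b
  ... | inj₁ b′               = inj₁ (there b′)
  ... | inj₂ (inj₁ (y∈ , z∈)) = inj₂ (inj₁ (there y∈ , z∈))
  ... | inj₂ (inj₂ b′)        = inj₂ (inj₂ b′)

  Adjacent-++⁻ : ∀ {y z} us vs → Adjacent y z (us ++ vs) →
    Adjacent y z us ⊎ (y ∈ us × ∃ λ r → vs ≡ z ∷ r) ⊎ Adjacent y z vs
  Adjacent-++⁻ []           vs       a         = inj₂ (inj₂ a)
  Adjacent-++⁻ (u ∷ [])     (v ∷ vs) here      = inj₂ (inj₁ (here refl , vs , refl))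
  Adjacent-++⁻ (u ∷ u′ ∷ us) vs      here      = inj₁ here
  Adjacent-++⁻ (u ∷ us)     vs       (there a) with Adjacent-++⁻ us vs a
  ... | inj₁ a′              = inj₁ (there a′)
  ... | inj₂ (inj₁ (y∈ , e)) = inj₂ (inj₁ (there y∈ , e))
  ... | inj₂ (inj₂ a′)       = inj₂ (inj₂ a′)

  Contains132-++ˡ : ∀ {r} s → Contains132 r → Contains132 (r ++ s)
  Contains132-++ˡ s (here b x<z z<y) = here (Before-++ˡ s b) x<z z<y
  Contains132-++ˡ s (there c) = there (Contains132-++ˡ s c)

  Contains132-++ʳ : ∀ us {r} → Contains132 r → Contains132 (us ++ r)
  Contains132-++ʳ []       c = c
  Contains132-++ʳ (u ∷ us) c = there (Contains132-++ʳ us c)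

  Contains1-23-++ˡ : ∀ {r} s → Contains1-23 r → Contains1-23 (r ++ s)
  Contains1-23-++ˡ s (here a x<y y<z) = here (Adjacent-++ˡ s a) x<y y<z
  Contains1-23-++ˡ s (there c) = there (Contains1-23-++ˡ s c)

  Contains1-23-++ʳ : ∀ us {r} → Contains1-23 r → Contains1-23 (us ++ r)
  Contains1-23-++ʳ []       c = c
  Contains1-23-++ʳ (u ∷ us) c = there (Contains1-23-++ʳ us c)

  Motzkin-++⁻ˡ : ∀ us vs → Motzkin (us ++ vs) → Motzkin us
  Motzkin-++⁻ˡ us vs (m₁ , m₂) = m₁ ∘ Contains132-++ˡ vs , m₂ ∘ Contains1-23-++ˡ vs

  Motzkin-++⁻ʳ : ∀ us vs → Motzkin (us ++ vs) → Motzkin vs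
  Motzkin-++⁻ʳ us vs (m₁ , m₂) = m₁ ∘ Contains132-++ʳ us , m₂ ∘ Contains1-23-++ʳ us

  data Cross132 (us vs : List ℕ) : Set where
    xy∣z : ∀ {x y z} → x ∈ us → y ∈ us → z ∈ vs → x < z → z < y → Cross132 us vs
    x∣yz : ∀ {x y z} → x ∈ us → Before y z vs → x < z → z < y → Cross132 us vs

  data Cross1-23 (us vs : List ℕ) : Set where
    xy∣z : ∀ {x y z} → x ∈ us → y ∈ us → (∃ λ r → vs ≡ z ∷ r) → x < y → y < z → Cross1-23 us vs
    x∣yz : ∀ {x y z} → x ∈ us → Adjacent y z vs → x < y → y < z → Cross1-23 us vs

  Contains132-++⁻ : ∀ us vs → Contains132 (us ++ vs) → Contains132 us ⊎ Contains132 vs ⊎ Cross132 us vs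
  Contains132-++⁻ []       vs c = inj₂ (inj₁ c)
  Contains132-++⁻ (u ∷ us) vs (here b x<z z<y) with Before-++⁻ us vs b
  ... | inj₁ b′               = inj₁ (here b′ x<z z<y)
  ... | inj₂ (inj₁ (y∈ , z∈)) = inj₂ (inj₂ (xy∣z (here refl) (there y∈) z∈ x<z z<y))
  ... | inj₂ (inj₂ b′)        = inj₂ (inj₂ (x∣yz (here refl) b′ x<z z<y))
  Contains132-++⁻ (u ∷ us) vs (there c) with Contains132-++⁻ us vs c
  ... | inj₁ c′                                   = inj₁ (there c′)
  ... | inj₂ (inj₁ c′)                            = inj₂ (inj₁ c′)
  ... | inj₂ (inj₂ (xy∣z x∈ y∈ z∈ x<z z<y)) = inj₂ (inj₂ (xy∣z (there x∈) (there y∈) z∈ x<z z<y))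
  ... | inj₂ (inj₂ (x∣yz x∈ b x<z z<y))    = inj₂ (inj₂ (x∣yz (there x∈) b x<z z<y))

  Contains1-23-++⁻ : ∀ us vs → Contains1-23 (us ++ vs) → Contains1-23 us ⊎ Contains1-23 vs ⊎ Cross1-23 us vs
  Contains1-23-++⁻ []       vs c = inj₂ (inj₁ c)
  Contains1-23-++⁻ (u ∷ us) vs (here a x<y y<z) with Adjacent-++⁻ us vs a
  ... | inj₁ a′              = inj₁ (here a′ x<y y<z)
  ... | inj₂ (inj₁ (y∈ , e)) = inj₂ (inj₂ (xy∣z (here refl) (there y∈) e x<y y<z))
  ... | inj₂ (inj₂ a′)       = inj₂ (inj₂ (x∣yz (here refl) a′ x<y y<z))
  Contains1-23-++⁻ (u ∷ us) vs (there c) with Contains1-23-++⁻ us vs c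
  ... | inj₁ c′                                    = inj₁ (there c′)
  ... | inj₂ (inj₁ c′)                             = inj₂ (inj₁ c′)
  ... | inj₂ (inj₂ (xy∣z x∈ y∈ e x<y y<z)) = inj₂ (inj₂ (xy∣z (there x∈) (there y∈) e x<y y<z))
  ... | inj₂ (inj₂ (x∣yz x∈ a x<y y<z))     = inj₂ (inj₂ (x∣yz (there x∈) a x<y y<z))

  Contains132-++-∷ : ∀ {x y N} xs ys → x ∈ xs → y ∈ ys → x < y → y < N → Contains132 (xs ++ N ∷ ys)
  Contains132-++-∷ {N = N} xs ys x∈xs y∈ys x<y y<N with us , vs , refl ← ∈-∃++ x∈xs =
    subst Contains132 (sym (++-assoc us _ (N ∷ ys))) (Contains132-++ʳ us (here (before vs) x<y y<N))
    where
    before : ∀ vs → Before N _ (vs ++ N ∷ ys)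
    before []       = here y∈ys
    before (v ∷ vs) = there (before vs)

  Contains1-23-++-∷∷ : ∀ {x l N} xs ys → x ∈ xs → x < l → l < N → Contains1-23 (xs ++ l ∷ N ∷ ys)
  Contains1-23-++-∷∷ {l = l} {N} xs ys x∈xs x<l l<N with us , vs , refl ← ∈-∃++ x∈xs =
    subst Contains1-23 (sym (++-assoc us _ (l ∷ N ∷ ys))) (Contains1-23-++ʳ us (here (adjacent vs) x<l l<N))
    where
    adjacent : ∀ vs → Adjacent l N (vs ++ l ∷ N ∷ ys)
    adjacent []       = here
    adjacent (v ∷ vs) = there (adjacent vs)

  <ᵇ-+ : ∀ c x y → (c + x <ᵇ c + y) ≡ (x <ᵇ y)
  <ᵇ-+ zero    x y = refl
  <ᵇ-+ (suc c) x y = <ᵇ-+ c x y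

  any-map : ∀ {A B : Set} (p : B → Bool) (q : A → Bool) (f : A → B) xs →
    (∀ x → p (f x) ≡ q x) → any p (map f xs) ≡ any q xs
  any-map p q f []       pf≡q = refl
  any-map p q f (x ∷ xs) pf≡q = cong₂ _∨_ (pf≡q x) (any-map p q f xs pf≡q)

  adjPairs-map : ∀ f w → adjPairs (map f w) ≡ map (λ (y , z) → f y , f z) (adjPairs w)
  adjPairs-map f []          = refl
  adjPairs-map f (x ∷ [])    = refl
  adjPairs-map f (x ∷ y ∷ w) = cong (_ ∷_) (adjPairs-map f (y ∷ w))

  has132-map-+ : ∀ c w → has132 (map (c +_) w) ≡ has132 w
  has132-map-+ c []      = refl
  has132-map-+ c (x ∷ r) = cong₂ _∨_ (from-map r) (has132-map-+ c r)
    where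
    from-map : ∀ r → has132From (c + x) (map (c +_) r) ≡ has132From x r
    from-map []      = refl
    from-map (y ∷ r) = cong₂ _∨_ (any-map _ _ (c +_) r (λ z → cong₂ _∧_ (<ᵇ-+ c x z) (<ᵇ-+ c z y))) (from-map r)

  hasBad-map-+ : ∀ c w → hasBad (map (c +_) w) ≡ hasBad w
  hasBad-map-+ c []      = refl
  hasBad-map-+ c (x ∷ r) = cong₂ _∨_
    (trans (cong (any _) (adjPairs-map (c +_) r))
           (any-map _ _ _ (adjPairs r) (λ (y , z) → cong₂ _∧_ (<ᵇ-+ c x y) (<ᵇ-+ c y z))))
    (hasBad-map-+ c r)

  Motzkin-map-+ : ∀ c w → Motzkin (map (c +_) w) ⇔ Motzkin w
  Motzkin-map-+ c w = mk⇔
    (λ m → to (isMotzkin⇔Motzkin w) (subst T (isMotzkin-map-+) (from (isMotzkin⇔Motzkin _) m)))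
    (λ m → to (isMotzkin⇔Motzkin _) (subst T (sym isMotzkin-map-+) (from (isMotzkin⇔Motzkin w) m)))
    where
    isMotzkin-map-+ : isMotzkin (map (c +_) w) ≡ isMotzkin w
    isMotzkin-map-+ = cong₂ (λ b b′ → not b ∧ not b′) (has132-map-+ c w) (hasBad-map-+ c w)

  fromBool : Bool → ℕ
  fromBool true  = 1
  fromBool false = 0

  countPairs : (ℕ → ℕ → Bool) → List ℕ → ℕ
  countPairs R w = length (filter (λ (y , z) → T? (R y z)) (adjPairs w))

  countPairs-∷∷ : ∀ R x y r → countPairs R (x ∷ y ∷ r) ≡ fromBool (R x y) + countPairs R (y ∷ r)
  countPairs-∷∷ R x y r with R x y
  ... | true  = refl
  ... | false = refl

  countPairs-++-∷ : ∀ R us v vs → countPairs R (us ++ v ∷ vs) ≡ countPairs R (us ++ [ v ]) + countPairs R (v ∷ vs)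
  countPairs-++-∷ R []            v vs = refl
  countPairs-++-∷ R (u ∷ [])      v vs = begin
    countPairs R (u ∷ v ∷ vs)                    ≡⟨ countPairs-∷∷ R u v vs ⟩
    fromBool (R u v) + countPairs R (v ∷ vs)     ≡⟨ cong (_+ countPairs R (v ∷ vs)) (ℕ.+-identityʳ _) ⟨
    (fromBool (R u v) + 0) + countPairs R (v ∷ vs) ≡⟨ cong (_+ countPairs R (v ∷ vs)) (countPairs-∷∷ R u v []) ⟨
    countPairs R (u ∷ [ v ]) + countPairs R (v ∷ vs) ∎
    where open ≡-Reasoning
  countPairs-++-∷ R (u ∷ u′ ∷ us) v vs = begin
    countPairs R (u ∷ u′ ∷ us ++ v ∷ vs)
      ≡⟨ countPairs-∷∷ R u u′ (us ++ v ∷ vs) ⟩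
    fromBool (R u u′) + countPairs R (u′ ∷ us ++ v ∷ vs)
      ≡⟨ cong (fromBool (R u u′) +_) (countPairs-++-∷ R (u′ ∷ us) v vs) ⟩
    fromBool (R u u′) + (countPairs R (u′ ∷ us ++ [ v ]) + countPairs R (v ∷ vs))
      ≡⟨ ℕ.+-assoc (fromBool (R u u′)) _ _ ⟨
    (fromBool (R u u′) + countPairs R (u′ ∷ us ++ [ v ])) + countPairs R (v ∷ vs)
      ≡⟨ cong (_+ countPairs R (v ∷ vs)) (countPairs-∷∷ R u u′ (us ++ [ v ])) ⟨
    countPairs R (u ∷ u′ ∷ us ++ [ v ]) + countPairs R (v ∷ vs) ∎
    where open ≡-Reasoning

  countPairs-map : ∀ R f → (∀ x y → R (f x) (f y) ≡ R x y) → ∀ w → countPairs R (map f w) ≡ countPairs R w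
  countPairs-map R f Rf≡R []          = refl
  countPairs-map R f Rf≡R (x ∷ [])    = refl
  countPairs-map R f Rf≡R (x ∷ y ∷ w) = begin
    countPairs R (f x ∷ f y ∷ map f w)              ≡⟨ countPairs-∷∷ R (f x) (f y) (map f w) ⟩
    fromBool (R (f x) (f y)) + countPairs R (f y ∷ map f w)
      ≡⟨ cong₂ (λ b n → fromBool b + n) (Rf≡R x y) (countPairs-map R f Rf≡R (y ∷ w)) ⟩
    fromBool (R x y) + countPairs R (y ∷ w)          ≡⟨ countPairs-∷∷ R x y w ⟨
    countPairs R (x ∷ y ∷ w)                         ∎
    where open ≡-Reasoning

  <ᵇ-true : ∀ {m n} → m < n → (m <ᵇ n) ≡ true
  <ᵇ-true m<n = to T-≡ (ℕ.<⇒<ᵇ m<n)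

  <ᵇ-false : ∀ {m n} → n < m → (m <ᵇ n) ≡ false
  <ᵇ-false {m} {n} n<m with m <ᵇ n in m<ᵇn
  ... | false = refl
  ... | true  = ⊥-elim (ℕ.<-asym n<m (ℕ.<ᵇ⇒< m n (subst T (sym m<ᵇn) _)))

  nonEmpty : List ℕ → ℕ
  nonEmpty []      = 0
  nonEmpty (_ ∷ _) = 1

  descents⁺ : List ℕ → ℕ
  descents⁺ w = nonEmpty w + descents w

  rises-∷-max : ∀ N β → All (_< N) β → rises (N ∷ β) ≡ rises β
  rises-∷-max N []      _           = refl
  rises-∷-max N (y ∷ β) (y<N ∷ _) =
    trans (countPairs-∷∷ _<ᵇ_ N y β) (cong (λ b → fromBool b + rises (y ∷ β)) (<ᵇ-false y<N))

  descents-∷-max : ∀ N β → All (_< N) β → descents (N ∷ β) ≡ descents⁺ β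
  descents-∷-max N []      _           = refl
  descents-∷-max N (y ∷ β) (y<N ∷ _) =
    trans (countPairs-∷∷ (λ y z → z <ᵇ y) N y β) (cong (λ b → fromBool b + descents (y ∷ β)) (<ᵇ-true y<N))

  rises-∷ʳ-min : ∀ v us → All (v <_) us → rises (us ++ [ v ]) ≡ rises us
  rises-∷ʳ-min v []            _           = refl
  rises-∷ʳ-min v (u ∷ [])      (v<u ∷ _) =
    trans (countPairs-∷∷ _<ᵇ_ u v []) (cong (λ b → fromBool b + 0) (<ᵇ-false v<u))
  rises-∷ʳ-min v (u ∷ u′ ∷ us) (_ ∷ v<us) = begin
    rises (u ∷ u′ ∷ us ++ [ v ])                       ≡⟨ countPairs-∷∷ _<ᵇ_ u u′ (us ++ [ v ]) ⟩
    fromBool (u <ᵇ u′) + rises (u′ ∷ us ++ [ v ])      ≡⟨ cong (fromBool (u <ᵇ u′) +_) (rises-∷ʳ-min v (u′ ∷ us) v<us) ⟩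
    fromBool (u <ᵇ u′) + rises (u′ ∷ us)               ≡⟨ countPairs-∷∷ _<ᵇ_ u u′ us ⟨
    rises (u ∷ u′ ∷ us)                                ∎
    where open ≡-Reasoning

  descents-∷ʳ-min : ∀ v us → All (v <_) us → descents (us ++ [ v ]) ≡ descents⁺ us
  descents-∷ʳ-min v []            _           = refl
  descents-∷ʳ-min v (u ∷ [])      (v<u ∷ _) =
    trans (countPairs-∷∷ (λ y z → z <ᵇ y) u v []) (cong (λ b → fromBool b + 0) (<ᵇ-true v<u))
  descents-∷ʳ-min v (u ∷ u′ ∷ us) (_ ∷ v<us) = begin
    descents (u ∷ u′ ∷ us ++ [ v ])                    ≡⟨ countPairs-∷∷ (λ y z → z <ᵇ y) u u′ (us ++ [ v ]) ⟩
    fromBool (u′ <ᵇ u) + descents (u′ ∷ us ++ [ v ])   ≡⟨ cong (fromBool (u′ <ᵇ u) +_) (descents-∷ʳ-min v (u′ ∷ us) v<us) ⟩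
    fromBool (u′ <ᵇ u) + suc (descents (u′ ∷ us))      ≡⟨ ℕ.+-suc _ _ ⟩
    suc (fromBool (u′ <ᵇ u) + descents (u′ ∷ us))      ≡⟨ cong suc (countPairs-∷∷ (λ y z → z <ᵇ y) u u′ us) ⟨
    descents⁺ (u ∷ u′ ∷ us)                            ∎
    where open ≡-Reasoning

  module _ {A : Set} where

    ∈-++-∷⁻ : ∀ {x z : A} us vs → z ∈ us ++ x ∷ vs → z ≢ x → z ∈ us ++ vs
    ∈-++-∷⁻ []       vs (here refl) z≢x = ⊥-elim (z≢x refl)
    ∈-++-∷⁻ []       vs (there z∈)  z≢x = z∈
    ∈-++-∷⁻ (u ∷ us) vs (here refl) z≢x = here refl
    ∈-++-∷⁻ (u ∷ us) vs (there z∈)  z≢x = there (∈-++-∷⁻ us vs z∈ z≢x)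

    length-++-∷ : ∀ {x : A} us vs → length (us ++ x ∷ vs) ≡ suc (length (us ++ vs))
    length-++-∷ []       vs = refl
    length-++-∷ (u ∷ us) vs = cong suc (length-++-∷ us vs)

    Unique⊆⇒length≤ : ∀ {xs ys : List A} → Unique xs → (∀ {z} → z ∈ xs → z ∈ ys) → length xs ≤ length ys
    Unique⊆⇒length≤ {[]}     _            _    = z≤n
    Unique⊆⇒length≤ {x ∷ xs} (x∉xs ∷ !xs) xs⊆ys with us , vs , refl ← ∈-∃++ (xs⊆ys (here refl)) =
      subst (suc (length xs) ≤_) (sym (length-++-∷ us vs))
        (s≤s (Unique⊆⇒length≤ !xs λ z∈xs →
          ∈-++-∷⁻ us vs (xs⊆ys (there z∈xs)) (λ { refl → All.lookup x∉xs z∈xs refl })))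

  Unique-bounded⇒length≤ : ∀ {xs k} → Unique xs → All (_< k) xs → length xs ≤ k
  Unique-bounded⇒length≤ {xs} {k} !xs xs<k =
    subst (length xs ≤_) (length-upTo k) (Unique⊆⇒length≤ !xs (∈-upTo⁺ ∘ All.lookup xs<k))

  record IsPerm (n : ℕ) (w : List ℕ) : Set where
    field
      length≡ : length w ≡ n
      unique  : Unique w
      bounded : All (_< n) w

  IsPerm-∈ : ∀ {n w v} → IsPerm n w → v < n → v ∈ w
  IsPerm-∈ {n} {w} {v} π v<n with v ∈? w
  ... | yes v∈w = v∈w
  ... | no  v∉w = ⊥-elim (ℕ.<-irrefl (IsPerm.length≡ π) (subst (length w <_) (length-upTo n) |v∷w|≤n))
    where
    |v∷w|≤n : length (v ∷ w) ≤ length (upTo n)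
    |v∷w|≤n = Unique⊆⇒length≤ (All.tabulate (λ z∈w v≡z → v∉w (subst (_∈ w) (sym v≡z) z∈w)) ∷ IsPerm.unique π)
      λ { (here refl) → ∈-upTo⁺ v<n ; (there z∈w) → ∈-upTo⁺ (All.lookup (IsPerm.bounded π) z∈w) }

  T-any-≡ᵇ⇔∈ : ∀ x xs → T (any (x ≡ᵇ_) xs) ⇔ x ∈ xs
  T-any-≡ᵇ⇔∈ x xs = mk⇔
    (Any.map (λ {y} → ℕ.≡ᵇ⇒≡ x y) ∘ any⁻ _ xs)
    (any⁺ _ ∘ Any.map (λ { refl → ℕ.≡⇒≡ᵇ x x refl }))

  distinct⇔Unique : ∀ w → T (distinct w) ⇔ Unique w
  distinct⇔Unique w = mk⇔ (to′ w) (from′ w)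
    where
    to′ : ∀ w → T (distinct w) → Unique w
    to′ []       _ = []
    to′ (x ∷ xs) h = let (x∉xs , !xs) = to T-∧ h in
      ¬Any⇒All¬ xs (to T-not x∉xs ∘ from (T-any-≡ᵇ⇔∈ x xs)) ∷ to′ xs !xs
    from′ : ∀ w → Unique w → T (distinct w)
    from′ []       _            = _
    from′ (x ∷ xs) (x∉xs ∷ !xs) = from T-∧ (from T-not (All¬⇒¬Any x∉xs ∘ to (T-any-≡ᵇ⇔∈ x xs)) , from′ xs !xs)

  words-suc : ∀ m n → words m (suc n) ≡ cartesianProductWith (λ w x → x ∷ w) (words m n) (upTo m)
  words-suc m n = concatMap≡ (words m n)
    where
    concatMap≡ : ∀ ws → concatMap (λ w → map (_∷ w) (upTo m)) ws ≡ cartesianProductWith (λ w x → x ∷ w) ws (upTo m)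
    concatMap≡ []       = refl
    concatMap≡ (w ∷ ws) = cong (map (_∷ w) (upTo m) ++_) (concatMap≡ ws)

  words-unique : ∀ m n → Unique (words m n)
  words-unique m zero    = [] ∷ []
  words-unique m (suc n) = subst Unique (sym (words-suc m n))
    (Unique.cartesianProductWith⁺ _ (λ { refl → refl , refl }) (words-unique m n) (Unique.upTo⁺ m))

  ∈-words⇔ : ∀ m n w → w ∈ words m n ⇔ (length w ≡ n × All (_< m) w)
  ∈-words⇔ m n w = mk⇔ (to′ n w) (from′ n w)
    where
    to′ : ∀ n w → w ∈ words m n → length w ≡ n × All (_< m) w
    to′ zero    .[] (here refl) = refl , []
    to′ (suc n) w   w∈ with ∈-cartesianProductWith⁻ _ (words m n) (upTo m) (subst (w ∈_) (words-suc m n) w∈)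
    ... | v , x , v∈ , x∈ , refl = let (|v| , v<m) = to′ n v v∈ in cong suc |v| , ∈-upTo⁻ x∈ ∷ v<m
    from′ : ∀ n w → length w ≡ n × All (_< m) w → w ∈ words m n
    from′ zero    []      _                    = here refl
    from′ (suc n) (x ∷ w) (|w| , x<m ∷ w<m) = subst (x ∷ w ∈_) (sym (words-suc m n))
      (∈-cartesianProductWith⁺ _ (from′ n w (ℕ.suc-injective |w| , w<m)) (∈-upTo⁺ x<m))

  perms-unique : ∀ n → Unique (perms n)
  perms-unique n = Unique.filter⁺ _ (words-unique n n)

  ∈-perms⇔ : ∀ n w → w ∈ perms n ⇔ IsPerm n w
  ∈-perms⇔ n w = mk⇔
    (λ w∈ → let (w∈words , d) = ∈-filter⁻ _ w∈ ; (|w| , w<n) = to (∈-words⇔ n n w) w∈words in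
       record { length≡ = |w| ; unique = to (distinct⇔Unique w) d ; bounded = w<n })
    (λ π → ∈-filter⁺ _ (from (∈-words⇔ n n w) (IsPerm.length≡ π , IsPerm.bounded π))
                        (from (distinct⇔Unique w) (IsPerm.unique π)))

  motzkinPerms : ℕ → List (List ℕ)
  motzkinPerms n = filter (λ w → T? (isMotzkin w)) (perms n)

  motzkinPerms-unique : ∀ n → Unique (motzkinPerms n)
  motzkinPerms-unique n = Unique.filter⁺ _ (perms-unique n)

  ∈-motzkinPerms⇔ : ∀ n w → w ∈ motzkinPerms n ⇔ (IsPerm n w × Motzkin w)
  ∈-motzkinPerms⇔ n w = mk⇔
    (λ w∈ → let (w∈perms , m) = ∈-filter⁻ _ w∈ in to (∈-perms⇔ n w) w∈perms , to (isMotzkin⇔Motzkin w) m)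
    (λ (π , m) → ∈-filter⁺ _ (from (∈-perms⇔ n w) π) (from (isMotzkin⇔Motzkin w) m))

  glue : ℕ → ℕ → List ℕ → List ℕ → List ℕ
  glue j N α β = map (suc j +_) α ++ j ∷ N ∷ β

  IsPerm-∷-max : ∀ {n β} → IsPerm n β → IsPerm (suc n) (n ∷ β)
  IsPerm-∷-max {n} π = record
    { length≡ = cong suc (IsPerm.length≡ π)
    ; unique  = All.map (λ y<n n≡y → ℕ.<-irrefl (sym n≡y) y<n) (IsPerm.bounded π) ∷ IsPerm.unique π
    ; bounded = ℕ.≤-refl ∷ All.map ℕ.m≤n⇒m≤1+n (IsPerm.bounded π)
    }

  Motzkin-∷-max : ∀ {N β} → All (_< N) β → Motzkin β → Motzkin (N ∷ β)
  Motzkin-∷-max {N} β<N (μ₁ , μ₂) = no132 , no1-23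
    where
    no132 : ¬ Contains132 (N ∷ _)
    no132 (here b N<z _)  = ℕ.<-asym N<z (All.lookup β<N (proj₂ (Before-∈ b)))
    no132 (there c)       = μ₁ c
    no1-23 : ¬ Contains1-23 (N ∷ _)
    no1-23 (here a N<y _) = ℕ.<-asym N<y (All.lookup β<N (proj₁ (Adjacent-∈ a)))
    no1-23 (there c)      = μ₂ c

  module GlueSound {i j m α β} (i+j≡m : i + j ≡ m)
    (πα : IsPerm i α) (μα : Motzkin α) (πβ : IsPerm j β) (μβ : Motzkin β) where

    N : ℕ
    N = suc m

    A R : List ℕ
    A = map (suc j +_) α
    R = j ∷ N ∷ β

    j<N : j < N
    j<N = s≤s (subst (j ≤_) i+j≡m (ℕ.m≤n+m j i))

    β<N : All (_< N) β
    β<N = All.map (λ y<j → ℕ.<-trans y<j j<N) (IsPerm.bounded πβ)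

    A-between : ∀ {v} → v ∈ A → j < v × v < N
    A-between v∈A with x , x∈α , refl ← ∈-map⁻ (suc j +_) v∈A =
      s≤s (ℕ.m≤m+n j x) ,
      s≤s (subst (j + x <_) (trans (ℕ.+-comm j i) i+j≡m) (ℕ.+-monoʳ-< j (All.lookup (IsPerm.bounded πα) x∈α)))

    R-≤N : ∀ {v} → v ∈ R → v ≤ N
    R-≤N (here refl)         = ℕ.<⇒≤ j<N
    R-≤N (there (here refl)) = ℕ.≤-refl
    R-≤N (there (there y∈β)) = ℕ.<⇒≤ (All.lookup β<N y∈β)

    R-above-j : ∀ {v} → v ∈ R → j < v → v ≡ N
    R-above-j (here refl)         j<j = ⊥-elim (ℕ.<-irrefl refl j<j)
    R-above-j (there (here refl)) _   = refl
    R-above-j (there (there y∈β)) j<y = ⊥-elim (ℕ.<-asym j<y (All.lookup (IsPerm.bounded πβ) y∈β))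

    N<⇒∉R : ∀ {v} → v ∈ R → N < v → ⊥
    N<⇒∉R v∈R N<v = ℕ.<-irrefl refl (ℕ.<-≤-trans N<v (R-≤N v∈R))

    motzkin : Motzkin (A ++ R)
    motzkin = no132 , no1-23
      where
      μA : Motzkin A
      μA = from (Motzkin-map-+ (suc j) α) μα
      μNβ : Motzkin (N ∷ β)
      μNβ = Motzkin-∷-max β<N μβ
      no132 : ¬ Contains132 (A ++ R)
      no132 c with Contains132-++⁻ A R c
      ... | inj₁ cA = proj₁ μA cA
      ... | inj₂ (inj₁ (here b j<z z<y)) = let (y∈ , z∈) = Before-∈ b in
            N<⇒∉R (there y∈) (subst (_< _) (R-above-j (there z∈) j<z) z<y)
      ... | inj₂ (inj₁ (there c′)) = proj₁ μNβ c′
      ... | inj₂ (inj₂ (xy∣z x∈A y∈A z∈R x<z z<y)) =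
            ℕ.<-asym (proj₂ (A-between y∈A)) (subst (_< _) (R-above-j z∈R (ℕ.<-trans (proj₁ (A-between x∈A)) x<z)) z<y)
      ... | inj₂ (inj₂ (x∣yz x∈A b x<z z<y)) = let (y∈ , z∈) = Before-∈ b in
            N<⇒∉R y∈ (subst (_< _) (R-above-j z∈ (ℕ.<-trans (proj₁ (A-between x∈A)) x<z)) z<y)
      no1-23 : ¬ Contains1-23 (A ++ R)
      no1-23 c with Contains1-23-++⁻ A R c
      ... | inj₁ cA = proj₂ μA cA
      ... | inj₂ (inj₁ (here a j<y y<z)) = let (y∈ , z∈) = Adjacent-∈ a in
            N<⇒∉R (there z∈) (subst (_< _) (R-above-j (there y∈) j<y) y<z)
      ... | inj₂ (inj₁ (there c′)) = proj₂ μNβ c′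
      ... | inj₂ (inj₂ (xy∣z x∈A y∈A (_ , refl) x<y y<j)) = ℕ.<-asym y<j (proj₁ (A-between y∈A))
      ... | inj₂ (inj₂ (x∣yz x∈A a x<y y<z)) = let (y∈ , z∈) = Adjacent-∈ a in
            N<⇒∉R z∈ (subst (_< _) (R-above-j y∈ (ℕ.<-trans (proj₁ (A-between x∈A)) x<y)) y<z)

    A-above-j : All (j <_) A
    A-above-j = All.tabulate (proj₁ ∘ A-between)

    isPerm : IsPerm (suc N) (A ++ R)
    isPerm = record { length≡ = length≡ ; unique = unique ; bounded = bounded }
      where
      open ≡-Reasoning
      length≡ : length (A ++ R) ≡ suc N
      length≡ = begin
        length (A ++ R)                         ≡⟨ length-++ A ⟩
        length A + suc (suc (length β))
          ≡⟨ cong₂ (λ a b → a + suc (suc b)) (trans (length-map _ α) (IsPerm.length≡ πα)) (IsPerm.length≡ πβ) ⟩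
        i + suc (suc j)                         ≡⟨ trans (ℕ.+-suc i (suc j)) (cong suc (ℕ.+-suc i j)) ⟩
        suc (suc (i + j))                       ≡⟨ cong (suc ∘ suc) i+j≡m ⟩
        suc N                                   ∎
      j≢ : ∀ {v} → v ∈ N ∷ β → j ≢ v
      j≢ (here refl) j≡N = ℕ.<-irrefl j≡N j<N
      j≢ (there y∈β) j≡y = ℕ.<-irrefl (sym j≡y) (All.lookup (IsPerm.bounded πβ) y∈β)
      unique : Unique (A ++ R)
      unique = Unique.++⁺ (Unique.map⁺ (ℕ.+-cancelˡ-≡ (suc j) _ _) (IsPerm.unique πα))
        (All.tabulate j≢ ∷ All.map (λ y<N N≡y → ℕ.<-irrefl (sym N≡y) y<N) β<N ∷ IsPerm.unique πβ)
        (λ (v∈A , v∈R) → let (j<v , v<N) = A-between v∈A in ℕ.<-irrefl (R-above-j v∈R j<v) v<N)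
      bounded : All (_< suc N) (A ++ R)
      bounded = All.tabulate λ v∈ → case ∈-++⁻ A v∈ of λ
        { (inj₁ v∈A) → ℕ.<-trans (proj₂ (A-between v∈A)) (ℕ.n<1+n N)
        ; (inj₂ v∈R) → s≤s (R-≤N v∈R) }

    N∉A++[j] : N ∉ A ++ [ j ]
    N∉A++[j] N∈ with ∈-++⁻ A N∈
    ... | inj₁ N∈A         = ℕ.<-irrefl refl (proj₂ (A-between N∈A))
    ... | inj₂ (here N≡j)  = ℕ.<-irrefl (sym N≡j) j<N

    length-A++[j] : length (A ++ [ j ]) ≡ suc i
    length-A++[j] = trans (length-++ A) (trans (cong (_+ 1) (trans (length-map _ α) (IsPerm.length≡ πα))) (ℕ.+-comm i 1))

    rises≡ : rises (A ++ R) ≡ suc (rises α + rises β)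
    rises≡ = begin
      rises (A ++ j ∷ N ∷ β)                 ≡⟨ countPairs-++-∷ _ A j (N ∷ β) ⟩
      rises (A ++ [ j ]) + rises (j ∷ N ∷ β) ≡⟨ cong₂ _+_ (rises-∷ʳ-min j A A-above-j) (countPairs-∷∷ _ j N β) ⟩
      rises A + (fromBool (j <ᵇ N) + rises (N ∷ β))
        ≡⟨ cong₂ (λ r b → r + (fromBool b + rises (N ∷ β))) (countPairs-map _ (suc j +_) (<ᵇ-+ (suc j)) α) (<ᵇ-true j<N) ⟩
      rises α + suc (rises (N ∷ β))          ≡⟨ cong (λ r → rises α + suc r) (rises-∷-max N β β<N) ⟩
      rises α + suc (rises β)                ≡⟨ ℕ.+-suc _ _ ⟩
      suc (rises α + rises β)                ∎
      where open ≡-Reasoning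

    descents≡ : descents (A ++ R) ≡ descents⁺ α + descents⁺ β
    descents≡ = begin
      descents (A ++ j ∷ N ∷ β)                    ≡⟨ countPairs-++-∷ _ A j (N ∷ β) ⟩
      descents (A ++ [ j ]) + descents (j ∷ N ∷ β) ≡⟨ cong₂ _+_ (descents-∷ʳ-min j A A-above-j) (countPairs-∷∷ _ j N β) ⟩
      descents⁺ A + (fromBool (N <ᵇ j) + descents (N ∷ β))
        ≡⟨ cong₂ (λ d b → nonEmpty A + d + (fromBool b + descents (N ∷ β)))
             (countPairs-map _ (suc j +_) (λ x y → <ᵇ-+ (suc j) y x) α) (<ᵇ-false j<N) ⟩
      nonEmpty A + descents α + descents (N ∷ β)
        ≡⟨ cong₂ (λ e d → e + descents α + d) (nonEmpty-map α) (descents-∷-max N β β<N) ⟩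
      descents⁺ α + descents⁺ β                   ∎
      where
      open ≡-Reasoning
      nonEmpty-map : ∀ α → nonEmpty (map (suc j +_) α) ≡ nonEmpty α
      nonEmpty-map []      = refl
      nonEmpty-map (_ ∷ _) = refl

  Unique-++⁻ : ∀ us {vs : List ℕ} → Unique (us ++ vs) →
    Unique us × Unique vs × (∀ {x y} → x ∈ us → y ∈ vs → x ≢ y)
  Unique-++⁻ []       !vs            = [] , !vs , λ ()
  Unique-++⁻ (u ∷ us) (u∉ ∷ !us++vs) =
    let (!us , !vs , us#vs) = Unique-++⁻ us !us++vs in
    All.tabulate (All.lookup u∉ ∘ ∈-++⁺ˡ) ∷ !us , !vs ,
    λ { (here refl) y∈vs → All.lookup u∉ (∈-++⁺ʳ us y∈vs) ; (there x∈us) y∈vs → us#vs x∈us y∈vs }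

  module Decompose {m xs l ys} (π : IsPerm (suc (suc m)) ((xs ++ [ l ]) ++ suc m ∷ ys))
    (μ : Motzkin ((xs ++ [ l ]) ++ suc m ∷ ys)) where

    N : ℕ
    N = suc m

    L : List ℕ
    L = xs ++ [ l ]

    w≡ : L ++ N ∷ ys ≡ xs ++ l ∷ N ∷ ys
    w≡ = ++-assoc xs [ l ] (N ∷ ys)

    !L : Unique L
    !L = proj₁ (Unique-++⁻ L (IsPerm.unique π))

    !ys : Unique ys
    !ys with _ , _ ∷ !ys , _ ← Unique-++⁻ L (IsPerm.unique π) = !ys

    L#N∷ys : ∀ {x v} → x ∈ L → v ∈ N ∷ ys → x ≢ v
    L#N∷ys = proj₂ (proj₂ (Unique-++⁻ L (IsPerm.unique π)))

    below-N : ∀ {v} → v ∈ L ++ N ∷ ys → v ≢ N → v < N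
    below-N v∈w v≢N = ℕ.≤∧≢⇒< (ℕ.≤-pred (All.lookup (IsPerm.bounded π) v∈w)) v≢N

    ys<N : ∀ {y} → y ∈ ys → y < N
    ys<N y∈ys with _ , N∉ys ∷ _ , _ ← Unique-++⁻ L (IsPerm.unique π) =
      below-N (∈-++⁺ʳ L (there y∈ys)) (λ { refl → All.lookup N∉ys y∈ys refl })

    L<N : ∀ {x} → x ∈ L → x < N
    L<N x∈L = below-N (∈-++⁺ˡ x∈L) (L#N∷ys x∈L (here refl))

    ys<L : ∀ {x y} → x ∈ L → y ∈ ys → y < x
    ys<L x∈L y∈ys = ℕ.≤∧≢⇒< (ℕ.≮⇒≥ (λ x<y → proj₁ μ (Contains132-++-∷ L ys x∈L y∈ys x<y (ys<N y∈ys))))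
      (λ y≡x → L#N∷ys x∈L (there y∈ys) (sym y≡x))

    l∈L : l ∈ L
    l∈L = ∈-++⁺ʳ xs (here refl)

    l<xs : ∀ {x} → x ∈ xs → l < x
    l<xs x∈xs =
      ℕ.≤∧≢⇒< (ℕ.≮⇒≥ (λ x<l → proj₂ μ (subst Contains1-23 (sym w≡) (Contains1-23-++-∷∷ xs ys x∈xs x<l (L<N l∈L)))))
      (λ l≡x → proj₂ (proj₂ (Unique-++⁻ xs !L)) x∈xs (here refl) (sym l≡x))

    j : ℕ
    j = length ys

    ys<j : ∀ {y} → y ∈ ys → y < j
    ys<j {y} y∈ys = subst (_≤ j) (length-upTo (suc y)) (Unique⊆⇒length≤ (Unique.upTo⁺ (suc y)) ≤y⊆ys)
      where
      ≤y⊆ys : ∀ {v} → v ∈ upTo (suc y) → v ∈ ys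
      ≤y⊆ys v∈ with s≤s v≤y ← ∈-upTo⁻ v∈
                   with ∈-++⁻ L (IsPerm-∈ π (ℕ.<-trans (ℕ.≤-<-trans v≤y (ys<N y∈ys)) (ℕ.n<1+n N)))
      ... | inj₁ v∈L         = ⊥-elim (ℕ.<-irrefl refl (ℕ.≤-<-trans v≤y (ys<L v∈L y∈ys)))
      ... | inj₂ (here refl) = ⊥-elim (ℕ.<-irrefl refl (ℕ.≤-<-trans v≤y (ys<N y∈ys)))
      ... | inj₂ (there v∈ys) = v∈ys

    j≤L : ∀ {x} → x ∈ L → j ≤ x
    j≤L x∈L = Unique-bounded⇒length≤ !ys (All.tabulate (ys<L x∈L))

    i : ℕ
    i = length xs

    i+j≡m : i + j ≡ m
    i+j≡m = ℕ.suc-injective (ℕ.suc-injective (begin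
      suc (suc (i + j))                 ≡⟨ cong suc (ℕ.+-suc i j) ⟨
      suc (i + suc j)                   ≡⟨ cong (_+ suc j) (trans (ℕ.+-comm 1 i) (sym (length-++ xs))) ⟩
      length L + suc j                  ≡⟨ length-++ L ⟨
      length (L ++ N ∷ ys)              ≡⟨ IsPerm.length≡ π ⟩
      suc (suc m)                       ∎))
      where open ≡-Reasoning

    j<N : j < N
    j<N = s≤s (subst (j ≤_) i+j≡m (ℕ.m≤n+m j i))

    l≡j : l ≡ j
    l≡j with ∈-++⁻ L (IsPerm-∈ π (ℕ.<-trans j<N (ℕ.n<1+n N)))
    ... | inj₂ (here j≡N)   = ⊥-elim (ℕ.<-irrefl j≡N j<N)
    ... | inj₂ (there j∈ys) = ⊥-elim (ℕ.<-irrefl refl (ys<j j∈ys))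
    ... | inj₁ j∈L with ∈-++⁻ xs j∈L
    ...   | inj₁ j∈xs        = ⊥-elim (ℕ.<-irrefl refl (ℕ.≤-<-trans (j≤L l∈L) (l<xs j∈xs)))
    ...   | inj₂ (here j≡l)  = sym j≡l

    α : List ℕ
    α = map (_∸ suc j) xs

    lift-α : map (suc j +_) α ≡ xs
    lift-α = trans (sym (map-∘ xs))
      (map-id-local (All.tabulate (λ x∈xs → ℕ.m+[n∸m]≡n (subst (_< _) l≡j (l<xs x∈xs)))))

    isPerm-α : IsPerm i α
    isPerm-α = record
      { length≡ = length-map _ xs
      ; unique  = Unique.map⁻ (subst Unique (sym lift-α) (proj₁ (Unique-++⁻ xs !L)))
      ; bounded = All.tabulate α<i
      }
      where
      α<i : ∀ {v} → v ∈ α → v < i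
      α<i v∈α with x , x∈xs , refl ← ∈-map⁻ _ v∈α =
        subst (x ∸ suc j <_) (ℕ.m+n∸m≡n (suc j) i) (ℕ.∸-monoˡ-< x<1+j+i (subst (_< x) l≡j (l<xs x∈xs)))
        where
        x<1+j+i : x < suc j + i
        x<1+j+i = subst (x <_) (cong suc (trans (sym i+j≡m) (ℕ.+-comm i j))) (L<N (∈-++⁺ˡ x∈xs))

    motzkin-α : Motzkin α
    motzkin-α = to (Motzkin-map-+ (suc j) α)
      (subst Motzkin (sym lift-α) (Motzkin-++⁻ˡ xs (l ∷ N ∷ ys) (subst Motzkin w≡ μ)))

    isPerm-ys : IsPerm j ys
    isPerm-ys = record { length≡ = refl ; unique = !ys ; bounded = All.tabulate ys<j }

    motzkin-ys : Motzkin ys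
    motzkin-ys = Motzkin-++⁻ʳ [ N ] ys (Motzkin-++⁻ʳ L (N ∷ ys) μ)

    ≡glue : L ++ N ∷ ys ≡ glue j N α ys
    ≡glue = trans w≡ (cong₂ (λ a v → a ++ v ∷ N ∷ ys) (sym lift-α) l≡j)

  ++-∷-cancel : ∀ {x : ℕ} us vs us′ vs′ → us ++ x ∷ vs ≡ us′ ++ x ∷ vs′ → x ∉ us → x ∉ us′ →
    us ≡ us′ × vs ≡ vs′
  ++-∷-cancel []       vs []         vs′ eq x∉ x∉′ = refl , ∷-injectiveʳ eq
  ++-∷-cancel []       vs (u′ ∷ us′) vs′ eq x∉ x∉′ = ⊥-elim (x∉′ (here (∷-injectiveˡ eq)))
  ++-∷-cancel (u ∷ us) vs []         vs′ eq x∉ x∉′ = ⊥-elim (x∉ (here (sym (∷-injectiveˡ eq))))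
  ++-∷-cancel (u ∷ us) vs (u′ ∷ us′) vs′ eq x∉ x∉′ with refl , eq′ ← ∷-injective eq
    with refl , refl ← ++-∷-cancel us vs us′ vs′ eq′ (x∉ ∘ there) (x∉′ ∘ there) = refl , refl

  ∉-map-suc-+ : ∀ j α → j ∉ map (suc j +_) α
  ∉-map-suc-+ j α j∈ with x , _ , j≡ ← ∈-map⁻ (suc j +_) j∈ = ℕ.<-irrefl j≡ (s≤s (ℕ.m≤m+n j x))

  glue-injective : ∀ {j N α α′ β β′} → glue j N α β ≡ glue j N α′ β′ → α ≡ α′ × β ≡ β′
  glue-injective {j} {N} {α} {α′} eq
    with α↑≡ , Nβ≡ ← ++-∷-cancel (map (suc j +_) α) _ (map (suc j +_) α′) _ eq
                                  (∉-map-suc-+ j α) (∉-map-suc-+ j α′) =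
    map-injective (ℕ.+-cancelˡ-≡ (suc j) _ _) α↑≡ , ∷-injectiveʳ Nβ≡

  gluings : ℕ → ℕ → List (List ℕ)
  gluings m i = cartesianProductWith (glue (m ∸ i) (suc m)) (motzkinPerms i) (motzkinPerms (m ∸ i))

  gluingsUpTo : ℕ → ℕ → List (List ℕ)
  gluingsUpTo m zero    = gluings m zero
  gluingsUpTo m (suc k) = gluingsUpTo m k ++ gluings m (suc k)

  decomposition : ℕ → List (List ℕ)
  decomposition m = map (suc m ∷_) (motzkinPerms (suc m)) ++ gluingsUpTo m m

  ∈-gluingsUpTo⇔ : ∀ m k {w} → w ∈ gluingsUpTo m k ⇔ ∃ λ i → i ≤ k × w ∈ gluings m i
  ∈-gluingsUpTo⇔ m k = mk⇔ (to′ k) (λ (i , i≤k , w∈) → from′ k i≤k w∈)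
    where
    to′ : ∀ k {w} → w ∈ gluingsUpTo m k → ∃ λ i → i ≤ k × w ∈ gluings m i
    to′ zero    w∈ = zero , z≤n , w∈
    to′ (suc k) w∈ with ∈-++⁻ (gluingsUpTo m k) w∈
    ... | inj₁ w∈′ = let (i , i≤k , w∈″) = to′ k w∈′ in i , ℕ.m≤n⇒m≤1+n i≤k , w∈″
    ... | inj₂ w∈′ = suc k , ℕ.≤-refl , w∈′
    from′ : ∀ k {i w} → i ≤ k → w ∈ gluings m i → w ∈ gluingsUpTo m k
    from′ zero    z≤n w∈ = w∈
    from′ (suc k) i≤  w∈ with ℕ.m≤n⇒m<n∨m≡n i≤
    ... | inj₁ (s≤s i≤k) = ∈-++⁺ˡ (from′ k i≤k w∈)
    ... | inj₂ refl      = ∈-++⁺ʳ (gluingsUpTo m k) w∈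

  ∈-gluings⁻ : ∀ {m i w} → w ∈ gluings m i → ∃₂ λ α β →
    (IsPerm i α × Motzkin α) × (IsPerm (m ∸ i) β × Motzkin β) × w ≡ glue (m ∸ i) (suc m) α β
  ∈-gluings⁻ {m} {i} w∈
    with α , β , α∈ , β∈ , refl ← ∈-cartesianProductWith⁻ _ (motzkinPerms i) (motzkinPerms (m ∸ i)) w∈ =
    α , β , to (∈-motzkinPerms⇔ i α) α∈ , to (∈-motzkinPerms⇔ (m ∸ i) β) β∈ , refl

  position-of-max : ∀ {m i w} → i ≤ m → w ∈ gluings m i →
    ∃₂ λ P Q → w ≡ P ++ suc m ∷ Q × suc m ∉ P × length P ≡ suc i
  position-of-max {m} {i} i≤m w∈ with α , β , (πα , μα) , (πβ , μβ) , refl ← ∈-gluings⁻ {m} {i} w∈ =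
    A ++ [ _ ] , β , sym (++-assoc A _ _) , N∉A++[j] , length-A++[j]
    where open GlueSound (ℕ.m+[n∸m]≡n i≤m) πα μα πβ μβ

  gluings-unique : ∀ m i → Unique (gluings m i)
  gluings-unique m i = Unique.cartesianProductWith⁺ _ glue-injective (motzkinPerms-unique i) (motzkinPerms-unique (m ∸ i))

  gluingsUpTo-unique : ∀ {m} k → k ≤ m → Unique (gluingsUpTo m k)
  gluingsUpTo-unique zero    _    = gluings-unique _ zero
  gluingsUpTo-unique {m} (suc k) 1+k≤m =
    Unique.++⁺ (gluingsUpTo-unique k (ℕ.<⇒≤ 1+k≤m)) (gluings-unique m (suc k)) disjoint
    where
    disjoint : ∀ {w} → ¬ (w ∈ gluingsUpTo m k × w ∈ gluings m (suc k))
    disjoint (w∈ , w∈′)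
      with i , i≤k , w∈″ ← to (∈-gluingsUpTo⇔ m k) w∈
      with P , Q , refl , N∉P , |P| ← position-of-max (ℕ.≤-trans i≤k (ℕ.<⇒≤ 1+k≤m)) w∈″
      with P′ , Q′ , eq , N∉P′ , |P′| ← position-of-max 1+k≤m w∈′
      with refl , _ ← ++-∷-cancel P Q P′ Q′ eq N∉P N∉P′ =
      ℕ.<-irrefl (ℕ.suc-injective (trans (sym |P|) |P′|)) (s≤s i≤k)

  decomposition-unique : ∀ m → Unique (decomposition m)
  decomposition-unique m =
    Unique.++⁺ (Unique.map⁺ ∷-injectiveʳ (motzkinPerms-unique (suc m))) (gluingsUpTo-unique m ℕ.≤-refl) disjoint
    where
    disjoint : ∀ {w} → ¬ (w ∈ map (suc m ∷_) (motzkinPerms (suc m)) × w ∈ gluingsUpTo m m)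
    disjoint (w∈ , w∈′)
      with β , _ , refl ← ∈-map⁻ (suc m ∷_) w∈
      with i , i≤m , w∈″ ← to (∈-gluingsUpTo⇔ m m) w∈′
      with P , Q , eq , N∉P , |P| ← position-of-max i≤m w∈″
      with refl , _ ← ++-∷-cancel [] β P Q eq (λ ()) N∉P = ℕ.0≢1+n |P|

  decomposition-sound : ∀ m {w} → w ∈ decomposition m → IsPerm (suc (suc m)) w × Motzkin w
  decomposition-sound m w∈ with ∈-++⁻ (map (suc m ∷_) (motzkinPerms (suc m))) w∈
  ... | inj₁ w∈top with β , β∈ , refl ← ∈-map⁻ (suc m ∷_) w∈top =
    let (πβ , μβ) = to (∈-motzkinPerms⇔ (suc m) β) β∈ in IsPerm-∷-max πβ , Motzkin-∷-max (IsPerm.bounded πβ) μβ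
  ... | inj₂ w∈glued with i , i≤m , w∈gluings ← to (∈-gluingsUpTo⇔ m m) w∈glued
                     with α , β , (πα , μα) , (πβ , μβ) , refl ← ∈-gluings⁻ {m} {i} w∈gluings =
    isPerm , motzkin
    where open GlueSound (ℕ.m+[n∸m]≡n i≤m) πα μα πβ μβ

  decomposition-complete : ∀ m {w} → IsPerm (suc (suc m)) w → Motzkin w → w ∈ decomposition m
  decomposition-complete m {w} π μ with xs , ys , refl ← ∈-∃++ (IsPerm-∈ π (ℕ.n<1+n (suc m))) | initLast xs
  ... | [] =
    ∈-++⁺ˡ (∈-map⁺ (suc m ∷_) (from (∈-motzkinPerms⇔ (suc m) ys) (isPerm-ys , Motzkin-++⁻ʳ [ suc m ] ys μ)))
    where
    isPerm-ys : IsPerm (suc m) ys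
    isPerm-ys with N∉ys ∷ !ys ← IsPerm.unique π | _ ∷ ys<2+m ← IsPerm.bounded π = record
      { length≡ = ℕ.suc-injective (IsPerm.length≡ π)
      ; unique  = !ys
      ; bounded = All.tabulate λ y∈ys →
          ℕ.≤∧≢⇒< (ℕ.≤-pred (All.lookup ys<2+m y∈ys)) (λ { refl → All.lookup N∉ys y∈ys refl })
      }
  ... | xs′ ∷ʳ′ l = ∈-++⁺ʳ (map (suc m ∷_) (motzkinPerms (suc m)))
    (from (∈-gluingsUpTo⇔ m m) (D.i , i≤m , subst (_∈ gluings m D.i) (sym ≡glue′)
      (∈-cartesianProductWith⁺ _ (from (∈-motzkinPerms⇔ D.i D.α) (D.isPerm-α , D.motzkin-α))
                                  (from (∈-motzkinPerms⇔ (m ∸ D.i) ys) (subst (λ n → IsPerm n ys) (sym m∸i≡j) D.isPerm-ys , D.motzkin-ys)))))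
    where
    module D = Decompose π μ
    m∸i≡j : m ∸ D.i ≡ D.j
    m∸i≡j = trans (cong (_∸ D.i) (sym D.i+j≡m)) (ℕ.m+n∸m≡n D.i D.j)
    i≤m : D.i ≤ m
    i≤m = subst (D.i ≤_) D.i+j≡m (ℕ.m≤m+n D.i D.j)
    ≡glue′ : (xs′ ∷ʳ l) ++ suc m ∷ ys ≡ glue (m ∸ D.i) (suc m) D.α ys
    ≡glue′ = trans D.≡glue (cong (λ j → glue j (suc m) D.α ys) (sym m∸i≡j))

  motzkinPerms↭decomposition : ∀ m → motzkinPerms (suc (suc m)) ↭ decomposition m
  motzkinPerms↭decomposition m = ∼bag⇒↭ (unique∧set⇒bag (motzkinPerms-unique (suc (suc m))) (decomposition-unique m) (mk⇔
    (λ w∈ → let (π , μ) = to (∈-motzkinPerms⇔ (suc (suc m)) _) w∈ in decomposition-complete m π μ)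
    (λ w∈ → from (∈-motzkinPerms⇔ (suc (suc m)) _) (decomposition-sound m w∈))))

  count : (List ℕ → Bool) → List (List ℕ) → ℕ
  count P ws = length (filter (λ w → T? (P w)) ws)

  count-∷ : ∀ (P : List ℕ → Bool) w ws → count P (w ∷ ws) ≡ fromBool (P w) + count P ws
  count-∷ P w ws with P w
  ... | true  = refl
  ... | false = refl

  count-↭ : ∀ P {ws ws′} → ws ↭ ws′ → count P ws ≡ count P ws′
  count-↭ P ws↭ws′ = ↭-length (filter-↭ _ ws↭ws′)

  count-filter : ∀ (P Q : List ℕ → Bool) ws → count (λ w → P w ∧ Q w) ws ≡ count Q (filter (λ w → T? (P w)) ws)
  count-filter P Q []       = refl
  count-filter P Q (w ∷ ws) = trans (count-∷ (λ v → P v ∧ Q v) w ws)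
    (trans (cong (λ n → fromBool (P w ∧ Q w) + n) (count-filter P Q ws)) (sym count-filter-∷))
    where
    count-filter-∷ :
      count Q (filter (λ w → T? (P w)) (w ∷ ws)) ≡ fromBool (P w ∧ Q w) + count Q (filter (λ w → T? (P w)) ws)
    count-filter-∷ with P w
    ... | true  = count-∷ Q w _
    ... | false = refl

  withStats : (List ℕ → ℕ) → (List ℕ → ℕ) → ℕ → ℕ → List ℕ → Bool
  withStats r d a b w = (r w ≡ᵇ a) ∧ (d w ≡ᵇ b)

open MotzkinPermutations
open import Data.Integer using (+_)

module GeneratingPolynomials where

  open CommutativeRing ℤ⟦p,q⟧.commutativeRing renaming (_≈_ to _≋_)
  open import Algebra.Properties.Semiring.Exp semiring using (_^_; ^-homo-*)
  open import Algebra.Properties.CommutativeSemigroup *-commutativeSemigroup using (interchange)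
  open import Relation.Binary.Reasoning.Setoid setoid

  monomial : ℕ → ℕ → Carrier
  monomial c e = p′ ^ c * q′ ^ e

  q′^-coeff : ∀ e a b → (q′ ^ e) a b ≡ + fromBool ((0 ≡ᵇ a) ∧ (e ≡ᵇ b))
  q′^-coeff zero    zero    zero    = ≡.refl
  q′^-coeff zero    zero    (suc b) = ≡.refl
  q′^-coeff zero    (suc a) b       = ≡.refl
  q′^-coeff (suc e) a       b       =
    ≡.trans (ℤ⟦p,q⟧.const-*ₛ ℤ⟦q⟧.X (q′ ^ e) a b) (≡.trans (ℤ⟦q⟧.X-*ₛ ((q′ ^ e) a) b) (shifted a b))
    where
    shifted : ∀ a b → ℤ⟦q⟧.shift ((q′ ^ e) a) b ≡ + fromBool ((0 ≡ᵇ a) ∧ (suc e ≡ᵇ b))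
    shifted zero    zero    = ≡.refl
    shifted (suc a) zero    = ≡.refl
    shifted a       (suc b) = q′^-coeff e a b

  monomial-coeff : ∀ c e a b → monomial c e a b ≡ + fromBool ((c ≡ᵇ a) ∧ (e ≡ᵇ b))
  monomial-coeff zero    e a b = ≡.trans (*-identityˡ (q′ ^ e) a b) (q′^-coeff e a b)
  monomial-coeff (suc c) e a b =
    ≡.trans (*-assoc p′ (p′ ^ c) (q′ ^ e) a b) (≡.trans (ℤ⟦p,q⟧.X-*ₛ (monomial c e) a b) (shifted a))
    where
    shifted : ∀ a → ℤ⟦p,q⟧.shift (monomial c e) a b ≡ + fromBool ((suc c ≡ᵇ a) ∧ (e ≡ᵇ b))
    shifted zero    = ≡.refl
    shifted (suc a) = monomial-coeff c e a b

  gf : (List ℕ → ℕ) → (List ℕ → ℕ) → List (List ℕ) → Carrier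
  gf r d []       = 0#
  gf r d (w ∷ ws) = monomial (r w) (d w) + gf r d ws

  gf-coeff : ∀ r d ws a b → gf r d ws a b ≡ + count (withStats r d a b) ws
  gf-coeff r d []       a b = ≡.refl
  gf-coeff r d (w ∷ ws) a b = ≡.trans (≡.cong₂ ℤ._+_ (monomial-coeff (r w) (d w) a b) (gf-coeff r d ws a b))
    (≡.trans (≡.sym (ℤ.pos-+ (fromBool (withStats r d a b w)) (count (withStats r d a b) ws)))
             (≡.cong +_ (≡.sym (count-∷ (withStats r d a b) w ws))))

  gf-↭ : ∀ r d {ws ws′} → ws ↭ ws′ → gf r d ws ≋ gf r d ws′
  gf-↭ r d {ws} {ws′} ws↭ws′ a b =
    ≡.trans (gf-coeff r d ws a b) (≡.trans (≡.cong +_ (count-↭ _ ws↭ws′)) (≡.sym (gf-coeff r d ws′ a b)))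

  gf-++ : ∀ r d xs ys → gf r d (xs ++ ys) ≋ gf r d xs + gf r d ys
  gf-++ r d []       ys = sym (+-identityˡ (gf r d ys))
  gf-++ r d (x ∷ xs) ys = trans (+-congˡ {monomial (r x) (d x)} (gf-++ r d xs ys))
    (sym (+-assoc (monomial (r x) (d x)) (gf r d xs) (gf r d ys)))

  gf-map : ∀ r d f ws → gf r d (map f ws) ≡ gf (r ∘ f) (d ∘ f) ws
  gf-map r d f []       = ≡.refl
  gf-map r d f (w ∷ ws) = ≡.cong (λ g → monomial (r (f w)) (d (f w)) + g) (gf-map r d f ws)

  gf-cong : ∀ r d r′ d′ ws → (∀ {w} → w ∈ ws → r w ≡ r′ w × d w ≡ d′ w) → gf r d ws ≡ gf r′ d′ ws
  gf-cong r d r′ d′ []       _  = ≡.refl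
  gf-cong r d r′ d′ (w ∷ ws) eq = ≡.cong₂ _+_ (≡.cong₂ monomial (proj₁ (eq (here ≡.refl))) (proj₂ (eq (here ≡.refl))))
    (gf-cong r d r′ d′ ws (eq ∘ there))

  monomial-+ : ∀ c e r d → monomial (c ℕ.+ r) (e ℕ.+ d) ≋ monomial c e * monomial r d
  monomial-+ c e r d = trans (*-cong (^-homo-* p′ c r) (^-homo-* q′ e d)) (interchange (p′ ^ c) (p′ ^ r) (q′ ^ e) (q′ ^ d))

  gf-+ : ∀ c e r d ws → gf (λ w → c ℕ.+ r w) (λ w → e ℕ.+ d w) ws ≋ monomial c e * gf r d ws
  gf-+ c e r d []       = sym (zeroʳ (monomial c e))
  gf-+ c e r d (w ∷ ws) = begin
    monomial (c ℕ.+ r w) (e ℕ.+ d w) + gf (λ w → c ℕ.+ r w) (λ w → e ℕ.+ d w) ws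
      ≈⟨ +-cong (monomial-+ c e (r w) (d w)) (gf-+ c e r d ws) ⟩
    monomial c e * monomial (r w) (d w) + monomial c e * gf r d ws
      ≈⟨ distribˡ (monomial c e) (monomial (r w) (d w)) (gf r d ws) ⟨
    monomial c e * gf r d (w ∷ ws) ∎

  gf-cartesianProduct : ∀ g r d r₁ d₁ r₂ d₂ xs ys →
    (∀ {x y} → x ∈ xs → y ∈ ys → r (g x y) ≡ r₁ x ℕ.+ r₂ y × d (g x y) ≡ d₁ x ℕ.+ d₂ y) →
    gf r d (cartesianProductWith g xs ys) ≋ gf r₁ d₁ xs * gf r₂ d₂ ys
  gf-cartesianProduct g r d r₁ d₁ r₂ d₂ []       ys additive = sym (zeroˡ (gf r₂ d₂ ys))
  gf-cartesianProduct g r d r₁ d₁ r₂ d₂ (x ∷ xs) ys additive = begin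
    gf r d (map (g x) ys ++ cartesianProductWith g xs ys)
      ≈⟨ gf-++ r d (map (g x) ys) _ ⟩
    gf r d (map (g x) ys) + gf r d (cartesianProductWith g xs ys)
      ≈⟨ +-cong (reflexive (≡.trans (gf-map r d (g x) ys) (gf-cong _ _ _ _ ys (additive (here ≡.refl)))))
                (gf-cartesianProduct g r d r₁ d₁ r₂ d₂ xs ys (additive ∘ there)) ⟩
    gf (λ y → r₁ x ℕ.+ r₂ y) (λ y → d₁ x ℕ.+ d₂ y) ys + gf r₁ d₁ xs * gf r₂ d₂ ys
      ≈⟨ +-congʳ {gf r₁ d₁ xs * gf r₂ d₂ ys} (gf-+ (r₁ x) (d₁ x) r₂ d₂ ys) ⟩
    monomial (r₁ x) (d₁ x) * gf r₂ d₂ ys + gf r₁ d₁ xs * gf r₂ d₂ ys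
      ≈⟨ distribʳ (gf r₂ d₂ ys) (monomial (r₁ x) (d₁ x)) (gf r₁ d₁ xs) ⟨
    gf r₁ d₁ (x ∷ xs) * gf r₂ d₂ ys ∎

  gf-suc-rises : ∀ r d ws → gf (suc ∘ r) d ws ≋ p′ * gf r d ws
  gf-suc-rises r d ws = trans (gf-+ 1 0 r d ws) (*-congʳ {gf r d ws} (trans (*-identityʳ (p′ * 1#)) (*-identityʳ p′)))

  gf-suc-descents : ∀ r d ws → gf r (suc ∘ d) ws ≋ q′ * gf r d ws
  gf-suc-descents r d ws = trans (gf-+ 0 1 r d ws) (*-congʳ {gf r d ws} (trans (*-identityˡ (q′ * 1#)) (*-identityʳ q′)))

  gfM gfU : ℕ → Carrier
  gfM n = gf rises descents (motzkinPerms n)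
  gfU n = gf rises descents⁺ (motzkinPerms n)

  gluings-gf : ∀ {m i} → i ≤ m → gf rises descents (gluings m i) ≋ p′ * (gfU i * gfU (m ∸ i))
  gluings-gf {m} {i} i≤m = begin
    gf rises descents (gluings m i)
      ≈⟨ gf-cartesianProduct _ rises descents (suc ∘ rises) descents⁺ rises descents⁺
           (motzkinPerms i) (motzkinPerms (m ∸ i)) additive ⟩
    gf (suc ∘ rises) descents⁺ (motzkinPerms i) * gfU (m ∸ i)
      ≈⟨ *-congʳ {gfU (m ∸ i)} (gf-suc-rises rises descents⁺ (motzkinPerms i)) ⟩
    p′ * gfU i * gfU (m ∸ i)
      ≈⟨ *-assoc p′ (gfU i) (gfU (m ∸ i)) ⟩
    p′ * (gfU i * gfU (m ∸ i)) ∎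
    where
    additive : ∀ {α β} → α ∈ motzkinPerms i → β ∈ motzkinPerms (m ∸ i) →
      rises (glue (m ∸ i) (suc m) α β) ≡ suc (rises α) ℕ.+ rises β ×
      descents (glue (m ∸ i) (suc m) α β) ≡ descents⁺ α ℕ.+ descents⁺ β
    additive {α} {β} α∈ β∈ = rises≡ , descents≡
      where
      open GlueSound (ℕ.m+[n∸m]≡n i≤m) (proj₁ (to (∈-motzkinPerms⇔ i α) α∈)) (proj₂ (to (∈-motzkinPerms⇔ i α) α∈))
        (proj₁ (to (∈-motzkinPerms⇔ (m ∸ i) β) β∈)) (proj₂ (to (∈-motzkinPerms⇔ (m ∸ i) β) β∈))

  gluingsUpTo-gf : ∀ {m} k → k ≤ m →
    gf rises descents (gluingsUpTo m k) ≋ ℤ⟦t,p,q⟧.∑[ i ≤ k ] (p′ * (gfU i * gfU (m ∸ i)))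
  gluingsUpTo-gf zero    0≤m   = gluings-gf 0≤m
  gluingsUpTo-gf {m} (suc k) 1+k≤m = trans (gf-++ rises descents (gluingsUpTo m k) (gluings m (suc k)))
    (+-cong (gluingsUpTo-gf k (ℕ.<⇒≤ 1+k≤m)) (gluings-gf 1+k≤m))

  max-first-gf : ∀ m → gf rises descents (map (suc m ∷_) (motzkinPerms (suc m))) ≡ gfU (suc m)
  max-first-gf m = ≡.trans (gf-map rises descents (suc m ∷_) (motzkinPerms (suc m)))
    (gf-cong _ _ rises descents⁺ (motzkinPerms (suc m)) stats)
    where
    stats : ∀ {β} → β ∈ motzkinPerms (suc m) → rises (suc m ∷ β) ≡ rises β × descents (suc m ∷ β) ≡ descents⁺ β
    stats {β} β∈ = let β<1+m = IsPerm.bounded (proj₁ (to (∈-motzkinPerms⇔ (suc m) β) β∈)) in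
      rises-∷-max (suc m) β β<1+m , descents-∷-max (suc m) β β<1+m

  gfM-recurrence : ∀ m → gfM (suc (suc m)) ≋ gfU (suc m) + p′ * ℤ⟦t,p,q⟧._*ₛ_ gfU gfU m
  gfM-recurrence m = begin
    gfM (suc (suc m))
      ≈⟨ gf-↭ rises descents (motzkinPerms↭decomposition m) ⟩
    gf rises descents (decomposition m)
      ≈⟨ gf-++ rises descents (map (suc m ∷_) (motzkinPerms (suc m))) (gluingsUpTo m m) ⟩
    gf rises descents (map (suc m ∷_) (motzkinPerms (suc m))) + gf rises descents (gluingsUpTo m m)
      ≈⟨ +-cong (reflexive (max-first-gf m)) (gluingsUpTo-gf m ℕ.≤-refl) ⟩
    gfU (suc m) + ℤ⟦t,p,q⟧.∑[ i ≤ m ] (p′ * (gfU i * gfU (m ∸ i)))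
      ≈⟨ +-congˡ {gfU (suc m)} (ℤ⟦t,p,q⟧.∑-*ˡ m p′ _) ⟨
    gfU (suc m) + p′ * ℤ⟦t,p,q⟧._*ₛ_ gfU gfU m ∎

  gfU-suc : ∀ n → gfU (suc n) ≋ q′ * gfM (suc n)
  gfU-suc n = trans (reflexive (gf-cong rises descents⁺ rises (suc ∘ descents) (motzkinPerms (suc n)) nonempty))
    (gf-suc-descents rises descents (motzkinPerms (suc n)))
    where
    nonempty : ∀ {w} → w ∈ motzkinPerms (suc n) → rises w ≡ rises w × descents⁺ w ≡ suc (descents w)
    nonempty {[]}    w∈ with () ← IsPerm.length≡ (proj₁ (to (∈-motzkinPerms⇔ (suc n) []) w∈))
    nonempty {_ ∷ _} _  = ≡.refl , ≡.refl

  gfM-0 : gfM 0 ≋ 1#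
  gfM-0 = trans (+-identityʳ (monomial 0 0)) (*-identityˡ 1#)

  gfU-0 : gfU 0 ≋ 1#
  gfU-0 = gfM-0

open GeneratingPolynomials using (gfM; gfU; gfM-0; gfU-0; gfM-recurrence; gfU-suc; gf-coeff)

M≈gfM : M ≈ gfM
M≈gfM n a b = ≡.trans (≡.cong +_ (count-filter isMotzkin (withStats rises descents a b) (perms n)))
  (≡.sym (gf-coeff rises descents (motzkinPerms n) a b))

U : Series
U = gfU

module FunctionalEquations where

  open CommutativeRing ℤ⟦p,q⟧.commutativeRing renaming (_≈_ to _≋_)
  open import Relation.Binary.Reasoning.Setoid setoid

  t*-coeff : ∀ f n → (t S.* f) n ≋ ℤ⟦t,p,q⟧.shift f n
  t*-coeff f n = trans (S.*-congʳ {f} t≈X n) (ℤ⟦t,p,q⟧.X-*ₛ f n)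

  p*-coeff : ∀ f n → (p S.* f) n ≋ p′ * f n
  p*-coeff f n = trans (S.*-congʳ {f} p≈const-p′ n) (ℤ⟦t,p,q⟧.const-*ₛ p′ f n)

  q*-coeff : ∀ f n → (q S.* f) n ≋ q′ * f n
  q*-coeff f n = trans (S.*-congʳ {f} q≈const-q′ n) (ℤ⟦t,p,q⟧.const-*ₛ q′ f n)

  t²*-coeff : ∀ f n → (t S.* (t S.* f)) n ≋ ℤ⟦t,p,q⟧.shift (ℤ⟦t,p,q⟧.shift f) n
  t²*-coeff f zero    = t*-coeff (t S.* f) 0
  t²*-coeff f (suc n) = trans (t*-coeff (t S.* f) (suc n)) (t*-coeff f n)

  W : Series
  W = U S.* U

  M-equation-rhs : ∀ n → ((S.1# S.+ t S.* U) S.+ p S.* (t S.* (t S.* W))) n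
    ≋ (S.1# n + ℤ⟦t,p,q⟧.shift U n) + p′ * ℤ⟦t,p,q⟧.shift (ℤ⟦t,p,q⟧.shift W) n
  M-equation-rhs n =
    +-cong (+-congˡ {S.1# n} (t*-coeff U n)) (trans (p*-coeff (t S.* (t S.* W)) n) (*-congˡ {p′} (t²*-coeff W n)))

  M-equation : M ≈ ((S.1# S.+ t S.* U) S.+ p S.* (t S.* (t S.* W)))
  M-equation zero = begin
    M 0                       ≈⟨ trans (M≈gfM 0) gfM-0 ⟩
    1#                        ≈⟨ trans (+-cong (+-identityʳ 1#) (zeroʳ p′)) (+-identityʳ 1#) ⟨
    (1# + 0#) + p′ * 0#       ≈⟨ M-equation-rhs 0 ⟨
    _                         ∎
  M-equation (suc zero) = begin
    M 1                       ≈⟨ trans (M≈gfM 1) (trans gfM-0 (sym gfU-0)) ⟩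
    gfU 0                     ≈⟨ trans (+-cong (+-identityˡ (gfU 0)) (zeroʳ p′)) (+-identityʳ (gfU 0)) ⟨
    (0# + gfU 0) + p′ * 0#    ≈⟨ M-equation-rhs 1 ⟨
    _                         ∎
  M-equation (suc (suc m)) = begin
    M (suc (suc m))                 ≈⟨ trans (M≈gfM (suc (suc m))) (gfM-recurrence m) ⟩
    gfU (suc m) + p′ * W m          ≈⟨ +-congʳ {p′ * W m} (+-identityˡ (gfU (suc m))) ⟨
    (0# + gfU (suc m)) + p′ * W m   ≈⟨ M-equation-rhs (suc (suc m)) ⟨
    _                               ∎

  U-equation : U ≈ (S.1# S.+ q S.* (M S.- S.1#))
  U-equation zero = begin
    gfU 0                          ≈⟨ gfU-0 ⟩
    1#                             ≈⟨ sym (+-identityʳ 1#) ⟩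
    1# + 0#                        ≈⟨ +-congˡ {1#} (sym (zeroʳ q′)) ⟩
    1# + q′ * 0#                   ≈⟨ +-congˡ {1#} (*-congˡ {q′} (sym (-‿inverseʳ 1#))) ⟩
    1# + q′ * (1# - 1#)
      ≈⟨ +-congˡ {1#} (*-congˡ {q′} (+-congʳ {x = - 1#} (trans (sym gfM-0) (sym (M≈gfM 0))))) ⟩
    1# + q′ * (M 0 - 1#)           ≈⟨ +-congˡ {1#} (sym (q*-coeff (M S.- S.1#) 0)) ⟩
    (S.1# S.+ q S.* (M S.- S.1#)) 0 ∎
  U-equation (suc n) = begin
    gfU (suc n)                    ≈⟨ gfU-suc n ⟩
    q′ * gfM (suc n)               ≈⟨ *-congˡ {q′} (sym (M≈gfM (suc n))) ⟩
    q′ * M (suc n)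
      ≈⟨ *-congˡ {q′} (trans (sym (+-identityʳ (M (suc n)))) (+-congˡ {M (suc n)} (sym -0#≈0#))) ⟩
    q′ * (M (suc n) - 0#)          ≈⟨ sym (+-identityˡ _) ⟩
    0# + q′ * (M (suc n) - 0#)     ≈⟨ +-congˡ {0#} (sym (q*-coeff (M S.- S.1#) (suc n))) ⟩
    (S.1# S.+ q S.* (M S.- S.1#)) (suc n) ∎
    where open import Algebra.Properties.Ring ring using (-0#≈0#)

module SeriesAlgebra where

  open CommutativeRing ℤ⟦t,p,q⟧.commutativeRing hiding (_≈_)
  open import Relation.Binary.Reasoning.Setoid setoid

  -- The solver takes its coefficients in ℤ, where equality is decidable, so its normal forms are exact.
  ⟦_⟧ : ℤ → Series
  ⟦ c ⟧ = ℤ⟦t,p,q⟧.const (ℤ⟦p,q⟧.const (ℤ⟦q⟧.const c))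

  ⟦0⟧ : ⟦ + 0 ⟧ ≈ 0#
  ⟦0⟧ zero    zero    zero    = ≡.refl
  ⟦0⟧ zero    zero    (suc b) = ≡.refl
  ⟦0⟧ zero    (suc a) b       = ≡.refl
  ⟦0⟧ (suc n) a       b       = ≡.refl

  ⟦-⟧ : ∀ x → ⟦ ℤ.- x ⟧ ≈ (- ⟦ x ⟧)
  ⟦-⟧ x zero    zero    zero    = ≡.refl
  ⟦-⟧ x zero    zero    (suc b) = ≡.refl
  ⟦-⟧ x zero    (suc a) b       = ≡.refl
  ⟦-⟧ x (suc n) a       b       = ≡.refl

  ⟦⟧-homomorphism :
    CommutativeRing.rawRing ℤ.+-*-commutativeRing -Raw-AlmostCommutative⟶ fromCommutativeRing ℤ⟦t,p,q⟧.commutativeRing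
  ⟦⟧-homomorphism = record
    { ⟦_⟧ = ⟦_⟧
    ; +-homo = λ x y → trans (ℤ⟦t,p,q⟧.const-cong (trans₂ (ℤ⟦p,q⟧.const-cong (ℤ⟦q⟧.const-+ x y)) (ℤ⟦p,q⟧.const-+ _ _)))
                             (ℤ⟦t,p,q⟧.const-+ _ _)
    ; *-homo = λ x y → trans (ℤ⟦t,p,q⟧.const-cong (trans₂ (ℤ⟦p,q⟧.const-cong (ℤ⟦q⟧.const-* x y)) (ℤ⟦p,q⟧.const-* _ _)))
                             (ℤ⟦t,p,q⟧.const-* _ _)
    ; -‿homo = ⟦-⟧
    ; 0-homo = ⟦0⟧
    ; 1-homo = refl
    }
    where open CommutativeRing ℤ⟦p,q⟧.commutativeRing using () renaming (trans to trans₂)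

  ⟦⟧-≟ : ∀ x y → Maybe (⟦ x ⟧ ≈ ⟦ y ⟧)
  ⟦⟧-≟ x y with x ℤ.≟ y
  ... | yes ≡.refl = just refl
  ... | no  _      = nothing

  module SeriesSolver = RingSolver (CommutativeRing.rawRing ℤ.+-*-commutativeRing)
    (fromCommutativeRing ℤ⟦t,p,q⟧.commutativeRing) ⟦⟧-homomorphism ⟦⟧-≟

  open SeriesSolver using (solve; _:=_; _:+_; _:*_; _:-_; con)

  ·≈⟦⟧* : ∀ c f → (c · f) ≈ (⟦ c ⟧ * f)
  ·≈⟦⟧* c f n a b = ≡.sym (≡.trans (ℤ⟦t,p,q⟧.const-*ₛ _ f n a b)
    (≡.trans (ℤ⟦p,q⟧.const-*ₛ _ (f n) a b) (ℤ⟦q⟧.const-*ₛ c (f n a) b)))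

  complete-square : ∀ A K P → K ≈ ((P + A * K) + K * K) →
    (((1# - A) - ⟦ + 2 ⟧ * K) * ((1# - A) - ⟦ + 2 ⟧ * K)) ≈ ((1# - A) * (1# - A) - ⟦ + 4 ⟧ * P)
  complete-square A K P K≈ = begin
    ((1# - A) - ⟦ + 2 ⟧ * K) * ((1# - A) - ⟦ + 2 ⟧ * K)
      ≈⟨ solve 2 (λ A K → ((con (+ 1) :- A) :- con (+ 2) :* K) :* ((con (+ 1) :- A) :- con (+ 2) :* K)
                      := (con (+ 1) :- A) :* (con (+ 1) :- A) :- con (+ 4) :* ((K :- A :* K) :- K :* K)) refl A K ⟩
    (1# - A) * (1# - A) - ⟦ + 4 ⟧ * ((K - A * K) - K * K)
      ≈⟨ +-congˡ {(1# - A) * (1# - A)}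
           (-‿cong (*-congˡ {⟦ + 4 ⟧} (+-congʳ {x = - (K * K)} (+-congʳ {x = - (A * K)} K≈)))) ⟩
    (1# - A) * (1# - A) - ⟦ + 4 ⟧ * ((((P + A * K) + K * K) - A * K) - K * K)
      ≈⟨ solve 3 (λ A K P → (con (+ 1) :- A) :* (con (+ 1) :- A) :- con (+ 4) :* ((((P :+ A :* K) :+ K :* K) :- A :* K) :- K :* K)
                      := (con (+ 1) :- A) :* (con (+ 1) :- A) :- con (+ 4) :* P) refl A K P ⟩
    (1# - A) * (1# - A) - ⟦ + 4 ⟧ * P ∎

  A P K S₀ : Series
  A  = q * t
  P  = p * (q * (t * t))
  K  = P * U
  S₀ = (1# - A) - ⟦ + 2 ⟧ * K

  U-quadratic : U ≈ ((1# + A * U) + P * (U * U))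
  U-quadratic = begin
    U
      ≈⟨ FunctionalEquations.U-equation ⟩
    1# + q * (M - 1#)
      ≈⟨ +-congˡ {1#} (*-congˡ {q} (+-congʳ {x = - 1#} FunctionalEquations.M-equation)) ⟩
    1# + q * (((1# + t * U) + p * (t * (t * (U * U)))) - 1#)
      ≈⟨ solve 4 (λ q t p U → con (+ 1) :+ q :* (((con (+ 1) :+ t :* U) :+ p :* (t :* (t :* (U :* U)))) :- con (+ 1))
                          := (con (+ 1) :+ (q :* t) :* U) :+ (p :* (q :* (t :* t))) :* (U :* U)) refl q t p U ⟩
    (1# + A * U) + P * (U * U) ∎

  K-quadratic : K ≈ ((P + A * K) + K * K)
  K-quadratic = begin
    P * U
      ≈⟨ *-congˡ {P} U-quadratic ⟩
    P * ((1# + A * U) + P * (U * U))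
      ≈⟨ solve 3 (λ A P U → P :* ((con (+ 1) :+ A :* U) :+ P :* (U :* U))
                          := (P :+ A :* (P :* U)) :+ (P :* U) :* (P :* U)) refl A P U ⟩
    (P + A * K) + K * K ∎

  S₀-square : (S₀ * S₀) ≈ ((1# - A) * (1# - A) - ⟦ + 4 ⟧ * P)
  S₀-square = complete-square A K P K-quadratic

  S₀-constant : ∀ a b → S₀ 0 a b ≡ 1# 0 a b
  S₀-constant a b = ≡.trans (S₀≈ 0 a b)
    (≡.trans (≡.cong (λ z → 1# 0 a b ℤ.+ ℤ.- z) (FunctionalEquations.t*-coeff R 0 a b)) (ℤ.+-identityʳ (1# 0 a b)))
    where
    R : Series
    R = q + ⟦ + 2 ⟧ * (p * (q * (t * U)))
    S₀≈ : S₀ ≈ (1# - t * R)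
    S₀≈ = solve 4 (λ q t p U → (con (+ 1) :- q :* t) :- con (+ 2) :* ((p :* (q :* (t :* t))) :* U)
                          := con (+ 1) :- t :* (q :+ con (+ 2) :* (p :* (q :* (t :* U))))) refl q t p U

  ⊗⇒* : ∀ {f f′ g g′} → f ≈ f′ → g ≈ g′ → (f ⊗ g) ≈ (f′ * g′)
  ⊗⇒* {f} {f′} {g} {g′} f≈f′ g≈g′ = trans (⊗≈* f g) (*-cong f≈f′ g≈g′)

  ≈-refl : ∀ f → f ≈ f
  ≈-refl f n a b = ≡.refl

  1-qt≈ : (one ⊝ (q ⊗ t)) ≈ (1# - q * t)
  1-qt≈ = +-cong one≈1# (-‿cong (⊗≈* q t))

  radicand≈ : radicand ≈ ((1# - q * t) * (1# - q * t) - ⟦ + 4 ⟧ * (p * (q * (t * t))))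
  radicand≈ = +-cong (⊗⇒* 1-qt≈ 1-qt≈)
    (-‿cong (trans (·≈⟦⟧* (+ 4) (p ⊗ (q ⊗ (t ⊗ t))))
                   (*-congˡ {⟦ + 4 ⟧} (⊗⇒* (≈-refl p) (⊗⇒* (≈-refl q) (⊗≈* t t))))))

  numerator₀ denominator₀ : Series
  numerator₀   = (1# - q * t) - ⟦ + 2 ⟧ * (p * (q * ((1# - q) * (t * t))))
  denominator₀ = ⟦ + 2 ⟧ * (p * (q * (q * (t * t))))

  numerator≈ : ∀ S → numerator S ≈ (numerator₀ - S)
  numerator≈ S = +-cong
    (+-cong 1-qt≈ (-‿cong (trans (·≈⟦⟧* (+ 2) (p ⊗ (q ⊗ ((one ⊝ q) ⊗ (t ⊗ t)))))
      (*-congˡ {⟦ + 2 ⟧} (⊗⇒* (≈-refl p) (⊗⇒* (≈-refl q) (⊗⇒* (+-cong one≈1# (≈-refl (⊖ q))) (⊗≈* t t))))))))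
    (≈-refl (⊖ S))

  denominator⊗M≈ : (denominator ⊗ M) ≈ (denominator₀ * M)
  denominator⊗M≈ = ⊗⇒* (trans (·≈⟦⟧* (+ 2) (p ⊗ (q ⊗ (q ⊗ (t ⊗ t)))))
    (*-congˡ {⟦ + 2 ⟧} (⊗⇒* (≈-refl p) (⊗⇒* (≈-refl q) (⊗⇒* (≈-refl q) (⊗≈* t t)))))) (≈-refl M)

  numerator₀-S₀ : (numerator₀ - S₀) ≈ (denominator₀ * M)
  numerator₀-S₀ = begin
    numerator₀ - S₀
      ≈⟨ solve 4 (λ q t p U → ((con (+ 1) :- q :* t) :- con (+ 2) :* (p :* (q :* ((con (+ 1) :- q) :* (t :* t)))))
                                :- ((con (+ 1) :- q :* t) :- con (+ 2) :* ((p :* (q :* (t :* t))) :* U))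
                          := con (+ 2) :* (p :* (q :* (t :* t))) :* ((U :- con (+ 1)) :+ q)) refl q t p U ⟩
    ⟦ + 2 ⟧ * P * ((U - 1#) + q)
      ≈⟨ *-congˡ {⟦ + 2 ⟧ * P} (+-congʳ {q} (+-congʳ {x = - 1#} FunctionalEquations.U-equation)) ⟩
    ⟦ + 2 ⟧ * P * (((1# + q * (M - 1#)) - 1#) + q)
      ≈⟨ solve 4 (λ q t p M → con (+ 2) :* (p :* (q :* (t :* t))) :* (((con (+ 1) :+ q :* (M :- con (+ 1))) :- con (+ 1)) :+ q)
                          := (con (+ 2) :* (p :* (q :* (q :* (t :* t))))) :* M) refl q t p M ⟩
    denominator₀ * M ∎

  S₀-isSqrt : IsSqrt radicand S₀
  S₀-isSqrt = (λ a b → ≡.trans (S₀-constant a b) (≡.sym (one≈1# 0 a b))) , trans (⊗≈* S₀ S₀) S₀²≈radicand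
    where
    S₀²≈radicand : (S₀ * S₀) ≈ radicand
    S₀²≈radicand = trans S₀-square (sym radicand≈)

  square-root-unique : ∀ {S} → IsSqrt radicand S → S ≈ S₀
  square-root-unique {S} (S-constant , S²≈radicand) = ℤ⟦t,p,q⟧.square-root-unique halve
    (λ a b → ≡.trans (S-constant a b) (one≈1# 0 a b)) S₀-constant
    (trans (sym (⊗≈* S S)) (trans S²≈radicand (trans (sym (proj₂ S₀-isSqrt)) (⊗≈* S₀ S₀))))
    where
    double : ∀ x → + 2 ℤ.* x ≡ x ℤ.+ x
    double x = ≡.trans (ℤ.*-distribʳ-+ x (+ 1) (+ 1)) (≡.cong₂ ℤ._+_ (ℤ.*-identityˡ x) (ℤ.*-identityˡ x))
    halve : ∀ {x y : ℤ⟦p,q⟧.PowerSeries} →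
      (∀ a b → x a b ℤ.+ x a b ≡ y a b ℤ.+ y a b) → ∀ a b → x a b ≡ y a b
    halve {x} {y} x+x≡y+y a b = ℤ.*-cancelˡ-≡ (+ 2) (x a b) (y a b)
      (≡.trans (double (x a b)) (≡.trans (x+x≡y+y a b) (≡.sym (double (y a b)))))

  denominator⊗M≈numerator : ∀ S → IsSqrt radicand S → (denominator ⊗ M) ≈ numerator S
  denominator⊗M≈numerator S S-isSqrt = begin
    denominator ⊗ M        ≈⟨ denominator⊗M≈ ⟩
    denominator₀ * M       ≈⟨ numerator₀-S₀ ⟨
    numerator₀ - S₀        ≈⟨ +-congˡ {numerator₀} (-‿cong (sym (square-root-unique S-isSqrt))) ⟩
    numerator₀ - S         ≈⟨ numerator≈ S ⟨
    numerator S            ∎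

corollary3p12 :
  Σ Series (λ S → IsSqrt radicand S)
    × ((S : Series) → IsSqrt radicand S → (denominator ⊗ M) ≈ numerator S)
corollary3p12 = (S₀ , S₀-isSqrt) , denominator⊗M≈numerator
  where open SeriesAlgebra
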